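{- Let $(P^T_n)_{n\ge 0}$ be the sequence of polynomials in $m$ defined by $P^T_0(m)=0$, $P^T_1(m)=m$ and, for $n\ge 1$, $P^T_{n+1}(m)=P^T_n(m+1)+\sum_{k=1}^{n-1}P^T_k(m)\,P^T_{n-k}(m)$. For $q\ge 1$ let $\tau_{2q}$ denote the second leading coefficient of $P^T_{2q}$, i.e. the coefficient of $m^{q-1}$ in $P^T_{2q}$ (whose degree is $q$). Then $\tau_2=1$, $\tau_4=5$, and for every $q\ge 3$, $$\tau_{2q}=4^{q-1}+\frac{2(2q-5)(2q-3)(2q-1)}{3(q-2)}\binom{2(q-3)}{q-3}.$$
   Context: $P^T_n(m)$ counts untyped lambda terms of size $n$ with de Bruijn indices in $\{1,\dots,m\}$. -}

module Defs where

open import Data.Nat using (ℕ; zero; suc; _+_; _*_; _∸_)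
open import Data.List using (List; []; _∷_; map; foldr; upTo; _++_)

-- Polynomials in m with natural-number coefficients, as coefficient lists
-- (lowest degree first): a₀ ∷ a₁ ∷ … represents a₀ + a₁ m + a₂ m² + …
Poly : Set
Poly = List ℕ

eval : Poly → ℕ → ℕ
eval []      m = 0
eval (a ∷ p) m = a + m * eval p m

coeff : Poly → ℕ → ℕ
coeff []      j       = 0
coeff (a ∷ p) zero    = a
coeff (a ∷ p) (suc j) = coeff p j

infixl 6 _⊕_
infixl 7 _⊗_

_⊕_ : Poly → Poly → Poly
[]      ⊕ q       = q
(a ∷ p) ⊕ []      = a ∷ p
(a ∷ p) ⊕ (b ∷ q) = (a + b) ∷ (p ⊕ q)

scale : ℕ → Poly → Poly
scale a = map (a *_)

_⊗_ : Poly → Poly → Poly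
[]      ⊗ q = []
(a ∷ p) ⊗ q = scale a q ⊕ (0 ∷ (p ⊗ q))

-- shift p = the polynomial m ↦ p(m+1)
-- (a + m·p'(m))  ↦  a + (m+1)·p'(m+1)
shift : Poly → Poly
shift []      = []
shift (a ∷ p) = (a ∷ []) ⊕ ((1 ∷ 1 ∷ []) ⊗ shift p)

-- n-th element of a list of polynomials (zero polynomial if out of range)
nth : List Poly → ℕ → Poly
nth []      n       = []
nth (p ∷ t) zero    = p
nth (p ∷ t) (suc n) = nth t n

-- Σ_{k=1}^{n-1} P_k · P_{n-k}, where t = [P_0, …, P_n]
conv : List Poly → ℕ → Poly
conv t n = foldr _⊕_ [] (map (λ k → nth t k ⊗ nth t (n ∸ k)) (map suc (upTo (n ∸ 1))))

step : ℕ → List Poly → List Poly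
step n t = t ++ ((shift (nth t n) ⊕ conv t n) ∷ [])

-- table n = [P^T_0, …, P^T_n]
table : ℕ → List Poly
table zero          = [] ∷ []
table (suc zero)    = [] ∷ (0 ∷ 1 ∷ []) ∷ []
table (suc (suc n)) = step (suc n) (table (suc n))

PT : ℕ → Poly
PT n = nth (table n) n

-- τ_{2q} : coefficient of m^{q-1} in P^T_{2q}
τ : ℕ → ℕ
τ q = coeff (PT (2 * q)) (q ∸ 1)

module Submission where

-- P^T_n has degree ⌈n/2⌉ in m.  Reading the recurrence on the two top
-- coefficients yields four power series in an auxiliary variable y,
--   A = Σ [m^q] P_{2q−1} y^q,   B = Σ [m^{q−1}] P_{2q−1} y^q,
--   C = Σ [m^q] P_{2q} y^q,     T = Σ τ_{2q} y^q,
-- with A = y + A², C = A + 2AC, B = yC + 2AB + yC², T = θA + B + 2AT + 2BC,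
-- where θ = y·d/dy records the Taylor shift P_n(m+1).  For σ = 1 − 2A one has
-- σ² = 1 − 4y, and elimination gives Tσ⁵ = yσ³ + y², i.e.
-- T = y/(1 − 4y) + y²·D⁵ with D = Σ C(2n,n) yⁿ = σ⁻¹.  The ODE
-- (1 − 4y)·θD = 2yD gives 3·[yⁿ] D⁵ = C(2n,n)(2n+1)(2n+3), and reading off
-- [y^q] T yields the theorem.

module IndexArithmetic where
  open import Data.Nat
  open import Data.Nat.Properties
  open import Relation.Binary.PropositionalEquality

  two-suc : ∀ m → 2 * suc m ≡ suc (suc (2 * m))
  two-suc m = cong suc (+-suc m (m + 0))

  double-∸ : ∀ q a → 2 * q ∸ 2 * a ≡ 2 * (q ∸ a)
  double-∸ q a = sym (*-distribˡ-∸ 2 q a)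

  double-∸-odd : ∀ q a → a < q → 2 * q ∸ suc (2 * a) ≡ suc (2 * (q ∸ suc a))
  double-∸-odd (suc q) zero    _         = cong pred (two-suc q)
  double-∸-odd (suc q) (suc a) (s≤s a<q) =
    trans (cong₂ (λ u v → u ∸ suc v) (two-suc q) (two-suc a)) (double-∸-odd q a a<q)

  suc-∸ : ∀ {p a} → a ≤ p → suc p ∸ a ≡ suc (p ∸ a)
  suc-∸ = +-∸-assoc 1

  odd-∸-double : ∀ p a → a ≤ p → suc (2 * p) ∸ 2 * a ≡ suc (2 * (p ∸ a))
  odd-∸-double p a a≤p = trans (suc-∸ (*-monoʳ-≤ 2 a≤p)) (cong suc (double-∸ p a))

  ⌈double/2⌉ : ∀ m → ⌈ 2 * m /2⌉ ≡ m
  ⌈double/2⌉ zero    = refl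
  ⌈double/2⌉ (suc m) = trans (cong ⌈_/2⌉ (two-suc m)) (cong suc (⌈double/2⌉ m))

  ⌈odd/2⌉ : ∀ m → ⌈ suc (2 * m) /2⌉ ≡ suc m
  ⌈odd/2⌉ zero    = refl
  ⌈odd/2⌉ (suc m) = trans (cong (λ v → ⌈ suc v /2⌉) (two-suc m)) (cong suc (⌈odd/2⌉ m))

  ⌈/2⌉-subadditive : ∀ a b → ⌈ a /2⌉ + ⌈ b /2⌉ ≤ ⌈ suc (a + b) /2⌉
  ⌈/2⌉-subadditive zero          b = ⌈n/2⌉-mono (n≤1+n b)
  ⌈/2⌉-subadditive (suc zero)    b = ≤-refl
  ⌈/2⌉-subadditive (suc (suc a)) b = s≤s (⌈/2⌉-subadditive a b)

module CentralBinomial where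
  open import Data.Nat
  open import Data.Nat.Properties
  open import Data.Nat.Combinatorics
  open import Relation.Binary.PropositionalEquality
  open import Data.Nat.Tactic.RingSolver using (solve-∀)
  open IndexArithmetic using (two-suc)

  absorption : ∀ n k → suc k * (suc n C suc k) ≡ suc n * (n C k)
  absorption zero    zero    = refl
  absorption zero    (suc k) = *-zeroʳ (suc (suc k))
  absorption (suc n) zero    =
    trans (+-identityʳ _) (trans (nC1≡n (suc (suc n))) (sym (*-identityʳ (suc (suc n)))))
  absorption (suc n) (suc k) = begin
    suc (suc k) * (suc (suc n) C suc (suc k))
      ≡⟨ cong (suc (suc k) *_) (nCk+nC[k+1]≡[n+1]C[k+1] (suc n) (suc k)) ⟨
    suc (suc k) * (suc n C suc k + suc n C suc (suc k))
      ≡⟨ split (suc k) (suc n C suc k) (suc n C suc (suc k)) ⟩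
    suc k * (suc n C suc k) + suc n C suc k + suc (suc k) * (suc n C suc (suc k))
      ≡⟨ cong₂ (λ u v → u + suc n C suc k + v) (absorption n k) (absorption n (suc k)) ⟩
    suc n * (n C k) + suc n C suc k + suc n * (n C suc k)
      ≡⟨ merge (suc n) (n C k) (suc n C suc k) (n C suc k) ⟩
    suc n * (n C k + n C suc k) + suc n C suc k
      ≡⟨ cong (λ u → suc n * u + suc n C suc k) (nCk+nC[k+1]≡[n+1]C[k+1] n k) ⟩
    suc n * (suc n C suc k) + suc n C suc k
      ≡⟨ +-comm (suc n * (suc n C suc k)) _ ⟩
    suc (suc n) * (suc n C suc k) ∎
    where
    open ≡-Reasoning
    split : ∀ m a b → (1 + m) * (a + b) ≡ m * a + a + (1 + m) * b
    split = solve-∀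
    merge : ∀ m a b c → m * a + b + m * c ≡ m * (a + c) + b
    merge = solve-∀

  central : ℕ → ℕ
  central n = (2 * n) C n

  central-step : ∀ n → suc n * central (suc n) ≡ 2 * (1 + 2 * n) * central n
  central-step n = *-cancelˡ-≡ _ _ (suc n) (begin
    suc n * (suc n * (2 * suc n C suc n))
      ≡⟨ cong (λ v → suc n * (suc n * (v C suc n))) (two-suc n) ⟩
    suc n * (suc n * (suc (suc (2 * n)) C suc n))
      ≡⟨ cong (suc n *_) (absorption (suc (2 * n)) n) ⟩
    suc n * (suc (suc (2 * n)) * (suc (2 * n) C n))
      ≡⟨ cong (λ u → suc n * (suc (suc (2 * n)) * u)) symmetric ⟩
    suc n * (suc (suc (2 * n)) * (suc (2 * n) C suc n))
      ≡⟨ reorder n (suc (2 * n) C suc n) ⟩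
    suc (suc (2 * n)) * (suc n * (suc (2 * n) C suc n))
      ≡⟨ cong (suc (suc (2 * n)) *_) (absorption (2 * n) n) ⟩
    suc (suc (2 * n)) * (suc (2 * n) * central n)
      ≡⟨ reorder′ n (central n) ⟩
    suc n * (2 * (1 + 2 * n) * central n) ∎)
    where
    open ≡-Reasoning
    symmetric : suc (2 * n) C n ≡ suc (2 * n) C suc n
    symmetric = trans (nCk≡nC[n∸k] (≤-trans (m≤n+m n (suc n)) (≤-reflexive (sym odd≡))))
                      (cong (suc (2 * n) C_) (trans (cong (_∸ n) odd≡) (m+n∸n≡m (suc n) n)))
      where
      odd≡ : suc (2 * n) ≡ suc n + n
      odd≡ = cong suc (trans (cong (n +_) (+-identityʳ n)) (+-comm n n))
    reorder : ∀ n a → (1 + n) * ((2 + 2 * n) * a) ≡ (2 + 2 * n) * ((1 + n) * a)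
    reorder = solve-∀
    reorder′ : ∀ n a → (2 + 2 * n) * ((1 + 2 * n) * a) ≡ (1 + n) * (2 * (1 + 2 * n) * a)
    reorder′ = solve-∀

  -- h(n) = C(2n,n)(2n+1)(2n+3); it will turn out to be 3·[yⁿ] (1−4y)^{−5/2}.
  closedForm : ℕ → ℕ
  closedForm n = central n * (1 + 2 * n) * (3 + 2 * n)

  closedForm-step : ∀ n → suc n * closedForm (suc n) ≡ 2 * (1 + 2 * n) * (3 + 2 * n) * (5 + 2 * n) * central n
  closedForm-step n = begin
    suc n * (central (suc n) * (1 + 2 * suc n) * (3 + 2 * suc n))
      ≡⟨ regroup n (central (suc n)) ⟩
    suc n * central (suc n) * (3 + 2 * n) * (5 + 2 * n)
      ≡⟨ cong (λ v → v * (3 + 2 * n) * (5 + 2 * n)) (central-step n) ⟩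
    2 * (1 + 2 * n) * central n * (3 + 2 * n) * (5 + 2 * n)
      ≡⟨ regroup′ n (central n) ⟩
    2 * (1 + 2 * n) * (3 + 2 * n) * (5 + 2 * n) * central n ∎
    where
    open ≡-Reasoning
    regroup : ∀ n c → suc n * (c * (1 + 2 * suc n) * (3 + 2 * suc n)) ≡ suc n * c * (3 + 2 * n) * (5 + 2 * n)
    regroup = solve-∀
    regroup′ : ∀ n c → 2 * (1 + 2 * n) * c * (3 + 2 * n) * (5 + 2 * n) ≡ 2 * (1 + 2 * n) * (3 + 2 * n) * (5 + 2 * n) * c
    regroup′ = solve-∀

  closedForm-recurrence : ∀ n → suc n * closedForm (suc n) ≡ (10 + 4 * n) * closedForm n
  closedForm-recurrence n = trans (closedForm-step n) (regroup n (central n))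
    where
    regroup : ∀ n c → 2 * (1 + 2 * n) * (3 + 2 * n) * (5 + 2 * n) * c ≡ (10 + 4 * n) * (c * (1 + 2 * n) * (3 + 2 * n))
    regroup = solve-∀

module PowerSeries where
  open import Data.Nat using (ℕ; zero; suc)
  open import Data.Integer using (ℤ; _+_; _*_; -_; 0ℤ; 1ℤ)
  import Data.Integer.Properties as ℤP
  open import Data.Integer.Tactic.RingSolver using (solve-∀)
  open import Relation.Binary.PropositionalEquality
  open import Function using (_∘_)

  Series : Set
  Series = ℕ → ℤ

  infix 4 _≈_
  _≈_ : Series → Series → Set
  f ≈ g = ∀ n → f n ≡ g n

  ≈-refl : ∀ {f} → f ≈ f
  ≈-refl _ = refl

  ≈-sym : ∀ {f g} → f ≈ g → g ≈ f
  ≈-sym e n = sym (e n)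

  ≈-trans : ∀ {f g h} → f ≈ g → g ≈ h → f ≈ h
  ≈-trans e e′ n = trans (e n) (e′ n)

  infixl 6 _⊞_
  infixl 7 _⊠_
  infix  8 ⊟_

  _⊞_ : Series → Series → Series
  (f ⊞ g) n = f n + g n

  ⊟_ : Series → Series
  (⊟ f) n = - f n

  cst : ℤ → Series
  cst c zero    = c
  cst c (suc _) = 0ℤ

  𝟘 : Series
  𝟘 _ = 0ℤ

  cst-zero : cst 0ℤ ≈ 𝟘
  cst-zero zero    = refl
  cst-zero (suc _) = refl

  cst-⊞ : ∀ a b → cst (a + b) ≈ cst a ⊞ cst b
  cst-⊞ a b zero    = refl
  cst-⊞ a b (suc n) = refl

  -- Cauchy product, by recursion on the first factor:
  -- (f ⊠ g)ₙ₊₁ = f₀ gₙ₊₁ + ((f ∘ suc) ⊠ g)ₙ, i.e. f = f₀ + y·(f ∘ suc).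
  _⊠_ : Series → Series → Series
  (f ⊠ g) zero    = f 0 * g 0
  (f ⊠ g) (suc n) = f 0 * g (suc n) + ((f ∘ suc) ⊠ g) n

  ⊞-cong : ∀ {f f′ g g′} → f ≈ f′ → g ≈ g′ → f ⊞ g ≈ f′ ⊞ g′
  ⊞-cong ef eg n = cong₂ _+_ (ef n) (eg n)

  ⊠-cong : ∀ {f f′ g g′} → f ≈ f′ → g ≈ g′ → f ⊠ g ≈ f′ ⊠ g′
  ⊠-cong ef eg zero    = cong₂ _*_ (ef 0) (eg 0)
  ⊠-cong ef eg (suc n) =
    cong₂ _+_ (cong₂ _*_ (ef 0) (eg (suc n))) (⊠-cong (ef ∘ suc) eg n)

  ⊠-zeroˡ : ∀ g → 𝟘 ⊠ g ≈ 𝟘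
  ⊠-zeroˡ g zero    = refl
  ⊠-zeroˡ g (suc n) = trans (ℤP.+-identityˡ _) (⊠-zeroˡ g n)

  cst-⊠ : ∀ c f → cst c ⊠ f ≈ λ n → c * f n
  cst-⊠ c f zero    = refl
  cst-⊠ c f (suc n) = trans (cong (c * f (suc n) +_) (⊠-zeroˡ f n)) (ℤP.+-identityʳ _)

  ⊠-identityˡ : ∀ g → cst 1ℤ ⊠ g ≈ g
  ⊠-identityˡ g n = trans (cst-⊠ 1ℤ g n) (ℤP.*-identityˡ (g n))

  ⊠-distribʳ : ∀ f g h → (f ⊞ g) ⊠ h ≈ f ⊠ h ⊞ g ⊠ h
  ⊠-distribʳ f g h zero    = ℤP.*-distribʳ-+ (h 0) (f 0) (g 0)
  ⊠-distribʳ f g h (suc n) = begin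
    (f 0 + g 0) * h (suc n) + ((f ∘ suc ⊞ g ∘ suc) ⊠ h) n
      ≡⟨ cong₂ _+_ (ℤP.*-distribʳ-+ (h (suc n)) (f 0) (g 0))
                   (⊠-distribʳ (f ∘ suc) (g ∘ suc) h n) ⟩
    (f 0 * h (suc n) + g 0 * h (suc n)) + (((f ∘ suc) ⊠ h) n + ((g ∘ suc) ⊠ h) n)
      ≡⟨ interchange (f 0 * h (suc n)) (g 0 * h (suc n)) _ _ ⟩
    (f 0 * h (suc n) + ((f ∘ suc) ⊠ h) n) + (g 0 * h (suc n) + ((g ∘ suc) ⊠ h) n) ∎
    where
    open ≡-Reasoning
    interchange : ∀ a b c d → (a + b) + (c + d) ≡ (a + c) + (b + d)
    interchange = solve-∀

  ⊠-scaleˡ : ∀ c f g → (λ n → c * f n) ⊠ g ≈ λ n → c * (f ⊠ g) n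
  ⊠-scaleˡ c f g zero    = ℤP.*-assoc c (f 0) (g 0)
  ⊠-scaleˡ c f g (suc n) = begin
    c * f 0 * g (suc n) + ((λ k → c * f (suc k)) ⊠ g) n
      ≡⟨ cong₂ _+_ (ℤP.*-assoc c (f 0) (g (suc n))) (⊠-scaleˡ c (f ∘ suc) g n) ⟩
    c * (f 0 * g (suc n)) + c * ((f ∘ suc) ⊠ g) n
      ≡⟨ ℤP.*-distribˡ-+ c _ _ ⟨
    c * (f 0 * g (suc n) + ((f ∘ suc) ⊠ g) n) ∎
    where open ≡-Reasoning

  ⊠-comm : ∀ f g → f ⊠ g ≈ g ⊠ f
  ⊠-comm f g zero          = ℤP.*-comm (f 0) (g 0)
  ⊠-comm f g (suc zero)    = swap (f 0) (f 1) (g 0) (g 1)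
    where
    swap : ∀ a b c d → a * d + b * c ≡ c * b + d * a
    swap = solve-∀
  ⊠-comm f g (suc (suc m)) = begin
    f 0 * g (suc (suc m)) + ((f ∘ suc) ⊠ g) (suc m)
      ≡⟨ cong (f 0 * g (suc (suc m)) +_) (⊠-comm (f ∘ suc) g (suc m)) ⟩
    f 0 * g (suc (suc m)) + (g 0 * f (suc (suc m)) + ((g ∘ suc) ⊠ (f ∘ suc)) m)
      ≡⟨ cong (λ z → f 0 * g (suc (suc m)) + (g 0 * f (suc (suc m)) + z)) (⊠-comm (g ∘ suc) (f ∘ suc) m) ⟩
    f 0 * g (suc (suc m)) + (g 0 * f (suc (suc m)) + ((f ∘ suc) ⊠ (g ∘ suc)) m)
      ≡⟨ exchange (f 0 * g (suc (suc m))) (g 0 * f (suc (suc m))) _ ⟩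
    g 0 * f (suc (suc m)) + (f 0 * g (suc (suc m)) + ((f ∘ suc) ⊠ (g ∘ suc)) m)
      ≡⟨ cong (g 0 * f (suc (suc m)) +_) (⊠-comm f (g ∘ suc) (suc m)) ⟩
    g 0 * f (suc (suc m)) + ((g ∘ suc) ⊠ f) (suc m) ∎
    where
    open ≡-Reasoning
    exchange : ∀ a b c → a + (b + c) ≡ b + (a + c)
    exchange = solve-∀

  ⊠-assoc : ∀ f g h → (f ⊠ g) ⊠ h ≈ f ⊠ (g ⊠ h)
  ⊠-assoc f g h zero    = ℤP.*-assoc (f 0) (g 0) (h 0)
  ⊠-assoc f g h (suc n) = begin
    f 0 * g 0 * h (suc n) + (((f ⊠ g) ∘ suc) ⊠ h) n
      ≡⟨ cong (f 0 * g 0 * h (suc n) +_) (⊠-distribʳ (λ k → f 0 * g (suc k)) ((f ∘ suc) ⊠ g) h n) ⟩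
    f 0 * g 0 * h (suc n) + (((λ k → f 0 * g (suc k)) ⊠ h) n + (((f ∘ suc) ⊠ g) ⊠ h) n)
      ≡⟨ cong₂ (λ u v → f 0 * g 0 * h (suc n) + (u + v))
               (⊠-scaleˡ (f 0) (g ∘ suc) h n) (⊠-assoc (f ∘ suc) g h n) ⟩
    f 0 * g 0 * h (suc n) + (f 0 * ((g ∘ suc) ⊠ h) n + ((f ∘ suc) ⊠ (g ⊠ h)) n)
      ≡⟨ regroup (f 0) (g 0) (h (suc n)) _ _ ⟩
    f 0 * (g 0 * h (suc n) + ((g ∘ suc) ⊠ h) n) + ((f ∘ suc) ⊠ (g ⊠ h)) n ∎
    where
    open ≡-Reasoning
    regroup : ∀ a b c d e → a * b * c + (a * d + e) ≡ a * (b * c + d) + e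
    regroup = solve-∀

  ⊠-negˡ : ∀ f g → (⊟ f) ⊠ g ≈ ⊟ (f ⊠ g)
  ⊠-negˡ f g zero    = sym (ℤP.neg-distribˡ-* (f 0) (g 0))
  ⊠-negˡ f g (suc n) = trans
    (cong₂ _+_ (sym (ℤP.neg-distribˡ-* (f 0) (g (suc n)))) (⊠-negˡ (f ∘ suc) g n))
    (sym (ℤP.neg-distrib-+ (f 0 * g (suc n)) (((f ∘ suc) ⊠ g) n)))

  infixr 8 _^_
  _^_ : Series → ℕ → Series
  f ^ zero  = cst 1ℤ
  f ^ suc n = f ⊠ f ^ n

module SeriesSolver where
  open import Data.Nat using (zero; suc)
  open import Data.Integer using (_*_; -_; 1ℤ; +-*-rawRing)
  import Data.Integer.Properties as ℤP
  open import Data.Maybe using (Maybe; just; nothing)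
  open import Relation.Nullary using (yes; no)
  open import Relation.Binary.PropositionalEquality
  open import Relation.Binary.Structures using (IsEquivalence)
  open import Level using (0ℓ)
  open import Algebra.Solver.Ring.AlmostCommutativeRing
  open PowerSeries
  open import Algebra.Structures _≈_ using (IsCommutativeMonoid)
  open import Algebra.Structures.Biased _≈_ using (isCommutativeSemiringˡ; isCommutativeMonoidˡ)

  ≈-isEquivalence : IsEquivalence _≈_
  ≈-isEquivalence = record { refl = ≈-refl ; sym = ≈-sym ; trans = ≈-trans }

  ⊞-isCommutativeMonoid : IsCommutativeMonoid _⊞_ 𝟘
  ⊞-isCommutativeMonoid = isCommutativeMonoidˡ record
    { isSemigroup = record
      { isMagma = record { isEquivalence = ≈-isEquivalence ; ∙-cong = ⊞-cong }
      ; assoc   = λ f g h n → ℤP.+-assoc (f n) (g n) (h n) }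
    ; identityˡ = λ f n → ℤP.+-identityˡ (f n)
    ; comm      = λ f g n → ℤP.+-comm (f n) (g n) }

  ⊠-isCommutativeMonoid : IsCommutativeMonoid _⊠_ (cst 1ℤ)
  ⊠-isCommutativeMonoid = isCommutativeMonoidˡ record
    { isSemigroup = record
      { isMagma = record { isEquivalence = ≈-isEquivalence ; ∙-cong = ⊠-cong }
      ; assoc   = ⊠-assoc }
    ; identityˡ = ⊠-identityˡ
    ; comm      = ⊠-comm }

  seriesRing : AlmostCommutativeRing 0ℓ 0ℓ
  seriesRing = record
    { Carrier = Series ; _≈_ = _≈_ ; _+_ = _⊞_ ; _*_ = _⊠_ ; -_ = ⊟_ ; 0# = 𝟘 ; 1# = cst 1ℤ
    ; isAlmostCommutativeRing = record
      { isCommutativeSemiring = isCommutativeSemiringˡ record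
        { +-isCommutativeMonoid = ⊞-isCommutativeMonoid
        ; *-isCommutativeMonoid = ⊠-isCommutativeMonoid
        ; distribʳ              = λ h f g → ⊠-distribʳ f g h
        ; zeroˡ                 = ⊠-zeroˡ }
      ; -‿cong       = λ e n → cong -_ (e n)
      ; -‿*-distribˡ = ⊠-negˡ
      ; -‿+-comm     = λ f g n → sym (ℤP.neg-distrib-+ (f n) (g n)) } }

  cst-*-homo : ∀ a b → cst (a * b) ≈ cst a ⊠ cst b
  cst-*-homo a b n = sym (trans (cst-⊠ a (cst b) n) (lemma n))
    where
    lemma : ∀ n → a * cst b n ≡ cst (a * b) n
    lemma zero    = refl
    lemma (suc n) = ℤP.*-zeroʳ a

  cst-morphism : +-*-rawRing -Raw-AlmostCommutative⟶ seriesRing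
  cst-morphism = record
    { ⟦_⟧    = cst
    ; +-homo = cst-⊞
    ; *-homo = cst-*-homo
    ; -‿homo = λ { a zero → refl ; a (suc n) → refl }
    ; 0-homo = λ { zero → refl ; (suc n) → refl }
    ; 1-homo = λ _ → refl }

  -- Equality of integer coefficients is decidable, which lets the solver
  -- discard vanishing terms of normal forms.
  cst-≟ : ∀ a b → Maybe (cst a ≈ cst b)
  cst-≟ a b with a ℤP.≟ b
  ... | yes refl = just ≈-refl
  ... | no _     = nothing

  open import Algebra.Solver.Ring +-*-rawRing seriesRing cst-morphism cst-≟ public
    using (Polynomial; con; _:+_; _:*_; _:-_; :-_; _:^_; solve; _:=_)

module SeriesCalculus where
  open import Data.Nat using (zero; suc; _≤_; z≤n; s≤s)
  import Data.Nat.Properties as ℕP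
  open import Data.Integer using (+_; _+_; _*_; -_; 0ℤ; 1ℤ; NonZero)
  import Data.Integer.Properties as ℤP
  open import Data.Integer.Tactic.RingSolver using (solve-∀)
  open import Relation.Binary.PropositionalEquality
  open import Function using (_∘_)
  open import Data.Sum using (inj₂)
  open PowerSeries

  y : Series
  y 1 = 1ℤ
  y _ = 0ℤ

  y-⊠ : ∀ f n → (y ⊠ f) (suc n) ≡ f n
  y-⊠ f n = trans (cong (λ z → 0ℤ * f (suc n) + z) (⊠-cong y-tail ≈-refl n))
                  (trans (ℤP.+-identityˡ _) (⊠-identityˡ f n))
    where
    y-tail : y ∘ suc ≈ cst 1ℤ
    y-tail zero    = refl
    y-tail (suc k) = refl

  ⊠-zeroʳ : ∀ w → w ⊠ 𝟘 ≈ 𝟘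
  ⊠-zeroʳ w = ≈-trans (⊠-comm w 𝟘) (⊠-zeroˡ w)

  -- The Euler operator θ = y·d/dy, which multiplies the n-th coefficient by n.
  θ : Series → Series
  θ f n = + n * f n

  θ-cong : ∀ {f g} → f ≈ g → θ f ≈ θ g
  θ-cong e n = cong (λ z → + n * z) (e n)

  θ-kernel : ∀ {f} → θ f ≈ 𝟘 → ∀ n → f (suc n) ≡ 0ℤ
  θ-kernel {f} e n with ℤP.i*j≡0⇒i≡0∨j≡0 (+ suc n) (e (suc n))
  ... | inj₂ fₙ₊₁≡0 = fₙ₊₁≡0

  θ-⊞ : ∀ f g → θ (f ⊞ g) ≈ θ f ⊞ θ g
  θ-⊞ f g n = ℤP.*-distribˡ-+ (+ n) (f n) (g n)

  θ-cst : ∀ c → θ (cst c) ≈ 𝟘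
  θ-cst c zero    = ℤP.*-zeroˡ c
  θ-cst c (suc n) = ℤP.*-zeroʳ (+ suc n)

  θ-scale : ∀ c f → θ (cst c ⊠ f) ≈ cst c ⊠ θ f
  θ-scale c f n = begin
    + n * (cst c ⊠ f) n    ≡⟨ cong (λ z → + n * z) (cst-⊠ c f n) ⟩
    + n * (c * f n)        ≡⟨ ℤP.*-comm (+ n) (c * f n) ⟩
    c * f n * + n          ≡⟨ ℤP.*-assoc c (f n) (+ n) ⟩
    c * (f n * + n)        ≡⟨ cong (c *_) (ℤP.*-comm (f n) (+ n)) ⟩
    c * (+ n * f n)        ≡⟨ cst-⊠ c (θ f) n ⟨
    (cst c ⊠ θ f) n        ∎
    where open ≡-Reasoning

  θ-y : θ y ≈ y
  θ-y zero          = refl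
  θ-y (suc zero)    = refl
  θ-y (suc (suc n)) = ℤP.*-zeroʳ (+ suc (suc n))

  θ-⊠ : ∀ f g → θ (f ⊠ g) ≈ θ f ⊠ g ⊞ f ⊠ θ g
  θ-⊠ f g zero    = leibniz₀ (f 0) (g 0)
    where
    leibniz₀ : ∀ a b → + 0 * (a * b) ≡ + 0 * a * b + a * (+ 0 * b)
    leibniz₀ = solve-∀
  θ-⊠ f g (suc n) = begin
    + suc n * (f 0 * g (suc n) + ((f ∘ suc) ⊠ g) n)
      ≡⟨ expand (+ n) (f 0) (g (suc n)) (((f ∘ suc) ⊠ g) n) ⟩
    (+ 0 * f 0 * g (suc n) + + n * ((f ∘ suc) ⊠ g) n + ((f ∘ suc) ⊠ g) n) + f 0 * (+ suc n * g (suc n))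
      ≡⟨ cong (λ z → (+ 0 * f 0 * g (suc n) + z + ((f ∘ suc) ⊠ g) n) + f 0 * (+ suc n * g (suc n)))
              (θ-⊠ (f ∘ suc) g n) ⟩
    (+ 0 * f 0 * g (suc n) + ((θ (f ∘ suc) ⊠ g) n + ((f ∘ suc) ⊠ θ g) n) + ((f ∘ suc) ⊠ g) n)
      + f 0 * (+ suc n * g (suc n))
      ≡⟨ regroup (+ 0 * f 0 * g (suc n)) ((θ (f ∘ suc) ⊠ g) n) (((f ∘ suc) ⊠ θ g) n)
                 (((f ∘ suc) ⊠ g) n) (f 0 * (+ suc n * g (suc n))) ⟩
    (+ 0 * f 0 * g (suc n) + ((θ (f ∘ suc) ⊠ g) n + ((f ∘ suc) ⊠ g) n))
      + (f 0 * (+ suc n * g (suc n)) + ((f ∘ suc) ⊠ θ g) n)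
      ≡⟨ cong (λ z → (+ 0 * f 0 * g (suc n) + z) + (f 0 * (+ suc n * g (suc n)) + ((f ∘ suc) ⊠ θ g) n))
              (sym (⊠-distribʳ (θ (f ∘ suc)) (f ∘ suc) g n)) ⟩
    (+ 0 * f 0 * g (suc n) + ((θ (f ∘ suc) ⊞ (f ∘ suc)) ⊠ g) n)
      + (f 0 * (+ suc n * g (suc n)) + ((f ∘ suc) ⊠ θ g) n)
      ≡⟨ cong (λ z → (+ 0 * f 0 * g (suc n) + z) + (f 0 * (+ suc n * g (suc n)) + ((f ∘ suc) ⊠ θ g) n))
              (⊠-cong (λ k → sym (θ-tail (+ k) (f (suc k)))) ≈-refl n) ⟩
    (θ f ⊠ g ⊞ f ⊠ θ g) (suc n) ∎
    where
    open ≡-Reasoning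
    expand : ∀ m a b c → (+ 1 + m) * (a * b + c) ≡ (+ 0 * a * b + m * c + c) + a * ((+ 1 + m) * b)
    expand = solve-∀
    regroup : ∀ a b c d e → (a + (b + c) + d) + e ≡ (a + (b + d)) + (e + c)
    regroup = solve-∀
    θ-tail : ∀ m a → (+ 1 + m) * a ≡ m * a + a
    θ-tail = solve-∀

  ⊠-vanishes-below : ∀ g f m → (∀ k → k ≤ m → f k ≡ 0ℤ) → (g ⊠ f) m ≡ 0ℤ
  ⊠-vanishes-below g f zero    f≡0 = trans (cong (g 0 *_) (f≡0 0 z≤n)) (ℤP.*-zeroʳ (g 0))
  ⊠-vanishes-below g f (suc m) f≡0 = cong₂ _+_
    (trans (cong (g 0 *_) (f≡0 (suc m) ℕP.≤-refl)) (ℤP.*-zeroʳ (g 0)))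
    (⊠-vanishes-below (g ∘ suc) f m (λ k k≤m → f≡0 k (ℕP.m≤n⇒m≤1+n k≤m)))

  unit-cancel : ∀ w f → w 0 ≡ 1ℤ → w ⊠ f ≈ 𝟘 → f ≈ 𝟘
  unit-cancel w f w₀≡1 wf≡0 n = below n n ℕP.≤-refl
    where
    below : ∀ m k → k ≤ m → f k ≡ 0ℤ
    below m       zero    _         =
      trans (sym (ℤP.*-identityˡ (f 0))) (trans (cong (_* f 0) (sym w₀≡1)) (wf≡0 0))
    below (suc m) (suc k) (s≤s k≤m) = begin
      f (suc k)                                    ≡⟨ ℤP.+-identityʳ _ ⟨
      f (suc k) + 0ℤ                               ≡⟨ cong₂ _+_ lead rest ⟨
      w 0 * f (suc k) + ((w ∘ suc) ⊠ f) k          ≡⟨ wf≡0 (suc k) ⟩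
      0ℤ                                           ∎
      where
      open ≡-Reasoning
      lead : w 0 * f (suc k) ≡ f (suc k)
      lead = trans (cong (_* f (suc k)) w₀≡1) (ℤP.*-identityˡ _)
      rest : ((w ∘ suc) ⊠ f) k ≡ 0ℤ
      rest = ⊠-vanishes-below (w ∘ suc) f k (λ j j≤k → below m j (ℕP.≤-trans j≤k k≤m))

  ^-unit : ∀ {w} → w 0 ≡ 1ℤ → ∀ k → (w ^ k) 0 ≡ 1ℤ
  ^-unit w₀≡1 zero    = refl
  ^-unit w₀≡1 (suc k) = cong₂ _*_ w₀≡1 (^-unit w₀≡1 k)

  difference-zero : ∀ {f g} → f ⊞ ⊟ g ≈ 𝟘 → f ≈ g
  difference-zero {f} {g} e n = begin
    f n                    ≡⟨ ℤP.+-identityʳ (f n) ⟨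
    f n + 0ℤ               ≡⟨ cong (λ z → f n + z) (ℤP.+-inverseˡ (g n)) ⟨
    f n + (- g n + g n)    ≡⟨ ℤP.+-assoc (f n) (- g n) (g n) ⟨
    (f n + - g n) + g n    ≡⟨ cong (_+ g n) (e n) ⟩
    0ℤ + g n               ≡⟨ ℤP.+-identityˡ (g n) ⟩
    g n                    ∎
    where open ≡-Reasoning

  cst-cancel : ∀ c f g → .{{_ : NonZero c}} → cst c ⊠ f ≈ cst c ⊠ g → f ≈ g
  cst-cancel c f g e n =
    ℤP.*-cancelˡ-≡ c (f n) (g n) (trans (sym (cst-⊠ c f n)) (trans (e n) (cst-⊠ c g n)))

  -- To derive L ≈ R from known relations Xᵢ ≈ Yᵢ we exhibit
  -- a ring identity L = R + Σ Wᵢ·(Xᵢ − Yᵢ) (checked by the solver) and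
  -- observe that every summand Wᵢ·(Xᵢ − Yᵢ) vanishes.
  times-relation : ∀ {X Y} → X ≈ Y → ∀ W → W ⊠ (X ⊞ ⊟ Y) ≈ 𝟘
  times-relation {X} {Y} e W =
    ≈-trans (⊠-cong {f = W} ≈-refl (λ n → trans (cong (_+ - Y n) (e n)) (ℤP.+-inverseʳ (Y n))))
            (⊠-zeroʳ W)

  infixl 6 _⊞𝟘_
  _⊞𝟘_ : ∀ {Z₁ Z₂} → Z₁ ≈ 𝟘 → Z₂ ≈ 𝟘 → Z₁ ⊞ Z₂ ≈ 𝟘
  (e₁ ⊞𝟘 e₂) n = cong₂ _+_ (e₁ n) (e₂ n)

  by-certificate : ∀ {L R Z} → L ≈ R ⊞ Z → Z ≈ 𝟘 → L ≈ R
  by-certificate {R = R} e z n = trans (e n) (trans (cong (λ u → R n + u) (z n)) (ℤP.+-identityʳ _))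

module FiniteSums where
  open import Data.Nat as ℕ using (ℕ; zero; suc; _∸_; _<_; z≤n; s≤s)
  import Data.Nat.Properties as ℕP
  open import Data.Integer using (ℤ; _+_; _*_; 0ℤ)
  import Data.Integer.Properties as ℤP
  open import Data.Integer.Tactic.RingSolver using (solve-∀)
  open import Relation.Binary.PropositionalEquality
  open import Function using (_∘_)
  open PowerSeries
  open IndexArithmetic using (two-suc)

  Σ< : ℕ → (ℕ → ℤ) → ℤ
  Σ< zero    h = 0ℤ
  Σ< (suc m) h = h 0 + Σ< m (h ∘ suc)

  Σ<-cong : ∀ m {h h′} → (∀ i → i < m → h i ≡ h′ i) → Σ< m h ≡ Σ< m h′
  Σ<-cong zero    e = refl
  Σ<-cong (suc m) e = cong₂ _+_ (e 0 (s≤s z≤n)) (Σ<-cong m (λ i i<m → e (suc i) (s≤s i<m)))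

  Σ<-+ : ∀ m h h′ → Σ< m (λ i → h i + h′ i) ≡ Σ< m h + Σ< m h′
  Σ<-+ zero    h h′ = refl
  Σ<-+ (suc m) h h′ = trans (cong (λ w → h 0 + h′ 0 + w) (Σ<-+ m (h ∘ suc) (h′ ∘ suc)))
                            (interchange (h 0) (h′ 0) _ _)
    where
    interchange : ∀ a b c d → a + b + (c + d) ≡ a + c + (b + d)
    interchange = solve-∀

  Σ<-zero : ∀ m {h} → (∀ i → i < m → h i ≡ 0ℤ) → Σ< m h ≡ 0ℤ
  Σ<-zero zero    e = refl
  Σ<-zero (suc m) e = cong₂ _+_ (e 0 (s≤s z≤n)) (Σ<-zero m (λ i i<m → e (suc i) (s≤s i<m)))

  Σ<-last : ∀ m h → Σ< (suc m) h ≡ Σ< m h + h m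
  Σ<-last zero    h = trans (ℤP.+-identityʳ (h 0)) (sym (ℤP.+-identityˡ (h 0)))
  Σ<-last (suc m) h = trans (cong (λ w → h 0 + w) (Σ<-last m (h ∘ suc))) (sym (ℤP.+-assoc (h 0) _ _))

  Σ<-even-odd : ∀ m h → Σ< (2 ℕ.* m) h ≡ Σ< m (λ a → h (2 ℕ.* a)) + Σ< m (λ a → h (suc (2 ℕ.* a)))
  Σ<-even-odd zero    h = refl
  Σ<-even-odd (suc m) h = begin
    Σ< (2 ℕ.* suc m) h
      ≡⟨ cong (λ v → Σ< v h) (two-suc m) ⟩
    h 0 + (h 1 + Σ< (2 ℕ.* m) (h ∘ suc ∘ suc))
      ≡⟨ cong (λ w → h 0 + (h 1 + w)) (Σ<-even-odd m (h ∘ suc ∘ suc)) ⟩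
    h 0 + (h 1 + (Σ< m (λ a → h (suc (suc (2 ℕ.* a)))) + Σ< m (λ a → h (suc (suc (suc (2 ℕ.* a)))))))
      ≡⟨ cong₂ (λ u v → h 0 + (h 1 + (u + v))) (Σ<-cong m (λ a _ → cong h (sym (two-suc a))))
                                               (Σ<-cong m (λ a _ → cong (h ∘ suc) (sym (two-suc a)))) ⟩
    h 0 + (h 1 + (Σ< m (λ a → h (2 ℕ.* suc a)) + Σ< m (λ a → h (suc (2 ℕ.* suc a)))))
      ≡⟨ interchange (h 0) (h 1) _ _ ⟩
    Σ< (suc m) (λ a → h (2 ℕ.* a)) + Σ< (suc m) (λ a → h (suc (2 ℕ.* a))) ∎
    where
    open ≡-Reasoning
    interchange : ∀ a b c d → a + (b + (c + d)) ≡ (a + c) + (b + d)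
    interchange = solve-∀

  Σ<-even-odd′ : ∀ m h →
    Σ< (suc (2 ℕ.* m)) h ≡ Σ< (suc m) (λ a → h (2 ℕ.* a)) + Σ< m (λ a → h (suc (2 ℕ.* a)))
  Σ<-even-odd′ m h = begin
    Σ< (suc (2 ℕ.* m)) h                                  ≡⟨ Σ<-last (2 ℕ.* m) h ⟩
    Σ< (2 ℕ.* m) h + h (2 ℕ.* m)                          ≡⟨ cong (_+ h (2 ℕ.* m)) (Σ<-even-odd m h) ⟩
    Σ< m even + Σ< m odd + h (2 ℕ.* m)                    ≡⟨ swap (Σ< m even) (Σ< m odd) (h (2 ℕ.* m)) ⟩
    Σ< m even + h (2 ℕ.* m) + Σ< m odd                    ≡⟨ cong (_+ Σ< m odd) (Σ<-last m even) ⟨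
    Σ< (suc m) even + Σ< m odd                            ∎
    where
    open ≡-Reasoning
    even odd : ℕ → ℤ
    even a = h (2 ℕ.* a)
    odd  a = h (suc (2 ℕ.* a))
    swap : ∀ a b c → a + b + c ≡ a + c + b
    swap = solve-∀

  ⊠-as-Σ : ∀ f g n → (f ⊠ g) n ≡ Σ< (suc n) (λ i → f i * g (n ∸ i))
  ⊠-as-Σ f g zero    = sym (ℤP.+-identityʳ _)
  ⊠-as-Σ f g (suc n) = cong (λ w → f 0 * g (suc n) + w) (⊠-as-Σ (f ∘ suc) g n)

  ⊠-as-inner-Σ : ∀ f g n → f 0 ≡ 0ℤ → g 0 ≡ 0ℤ → (f ⊠ g) (suc n) ≡ Σ< n (λ a → f (suc a) * g (n ∸ a))
  ⊠-as-inner-Σ f g n f₀≡0 g₀≡0 = begin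
    (f ⊠ g) (suc n)
      ≡⟨ ⊠-as-Σ f g (suc n) ⟩
    f 0 * g (suc n) + Σ< (suc n) inner
      ≡⟨ cong₂ _+_ (cong (_* g (suc n)) f₀≡0) (Σ<-last n inner) ⟩
    0ℤ + (Σ< n inner + f (suc n) * g (n ∸ n))
      ≡⟨ cong (λ w → 0ℤ + (Σ< n inner + f (suc n) * w)) (trans (cong g (ℕP.n∸n≡0 n)) g₀≡0) ⟩
    0ℤ + (Σ< n inner + f (suc n) * 0ℤ)
      ≡⟨ trans (ℤP.+-identityˡ _) (trans (cong (λ w → Σ< n inner + w) (ℤP.*-zeroʳ (f (suc n)))) (ℤP.+-identityʳ _)) ⟩
    Σ< n inner ∎
    where
    open ≡-Reasoning
    inner : ℕ → ℤ
    inner a = f (suc a) * g (n ∸ a)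

module Degrees where
  open import Data.Nat as ℕ using (ℕ; zero; suc; _≤_; z≤n; s≤s)
  import Data.Nat.Properties as ℕP
  open import Data.Integer using (_+_; _*_; 0ℤ)
  import Data.Integer.Properties as ℤP
  open import Relation.Binary.PropositionalEquality
  open import Function using (_∘_)
  open PowerSeries

  VanishesFrom : Series → ℕ → Set
  VanishesFrom f d = ∀ j → d ≤ j → f j ≡ 0ℤ

  DegreeAtMost : Series → ℕ → Set
  DegreeAtMost f d = VanishesFrom f (suc d)

  tail-vanishes : ∀ {f} d → VanishesFrom f d → VanishesFrom (f ∘ suc) (ℕ.pred d)
  tail-vanishes zero    V j _   = V (suc j) z≤n
  tail-vanishes (suc d) V j d≤j = V (suc j) (s≤s d≤j)

  constant-⊠ : ∀ {f} g → DegreeAtMost f 0 → ∀ n → (f ⊠ g) n ≡ f 0 * g n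
  constant-⊠     g D zero    = refl
  constant-⊠ {f} g D (suc n) = trans
    (cong (λ w → f 0 * g (suc n) + w) (trans (⊠-cong {g = g} (λ j → D (suc j) (s≤s z≤n)) ≈-refl n) (⊠-zeroˡ g n)))
    (ℤP.+-identityʳ _)

  ⊠-degree : ∀ a b {f g} → DegreeAtMost f a → DegreeAtMost g b → DegreeAtMost (f ⊠ g) (a ℕ.+ b)
  ⊠-degree zero    b {f} {g} Df Dg j       b<j       =
    trans (constant-⊠ g Df j) (trans (cong (f 0 *_) (Dg j b<j)) (ℤP.*-zeroʳ (f 0)))
  ⊠-degree (suc a) b {f} {g} Df Dg (suc j) (s≤s a+b<j) = cong₂ _+_
    (trans (cong (f 0 *_) (Dg (suc j) (s≤s (ℕP.≤-trans (ℕP.m≤n+m b a) (ℕP.<⇒≤ a+b<j))))) (ℤP.*-zeroʳ (f 0)))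
    (⊠-degree a b (tail-vanishes (suc (suc a)) Df) Dg j a+b<j)

  ⊠-top : ∀ a b {f g N} → DegreeAtMost f a → DegreeAtMost g b → a ℕ.+ b ≡ N →
    (f ⊠ g) N ≡ f a * g b
  ⊠-top zero    b {f} {g} Df Dg refl = constant-⊠ g Df b
  ⊠-top (suc a) b {f} {g} Df Dg refl = trans
    (cong₂ _+_ (trans (cong (f 0 *_) (Dg (suc (a ℕ.+ b)) (s≤s (ℕP.m≤n+m b a)))) (ℤP.*-zeroʳ (f 0)))
               (⊠-top a b (tail-vanishes (suc (suc a)) Df) Dg refl))
    (ℤP.+-identityˡ _)

  ⊠-second : ∀ a b {f g N} → DegreeAtMost f (suc a) → DegreeAtMost g (suc b) → suc (a ℕ.+ b) ≡ N →
    (f ⊠ g) N ≡ f (suc a) * g b + f a * g (suc b)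
  ⊠-second zero    b {f} {g} Df Dg refl = trans
    (cong (λ w → f 0 * g (suc b) + w) (constant-⊠ g (tail-vanishes 2 Df) b))
    (ℤP.+-comm (f 0 * g (suc b)) _)
  ⊠-second (suc a) b {f} {g} Df Dg refl = trans
    (cong₂ _+_ (trans (cong (f 0 *_) (Dg (suc (suc (a ℕ.+ b))) (s≤s (s≤s (ℕP.m≤n+m b a))))) (ℤP.*-zeroʳ (f 0)))
               (⊠-second a b (tail-vanishes (suc (suc (suc a))) Df) Dg refl))
    (ℤP.+-identityˡ _)

module PolyCoefficients where
  open import Data.Nat as ℕ using (zero; suc; z≤n)
  import Data.Nat.Properties as ℕP
  open import Data.Integer using (+_; _+_; _*_; 0ℤ; 1ℤ)
  import Data.Integer.Properties as ℤP
  open import Data.Integer.Tactic.RingSolver using (solve-∀)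
  open import Data.List using ([]; _∷_)
  open import Relation.Binary.PropositionalEquality
  open import Defs
  open PowerSeries
  open Degrees

  coeffs : Poly → Series
  coeffs p n = + coeff p n

  coeff-⊕ : ∀ p q j → coeff (p ⊕ q) j ≡ coeff p j ℕ.+ coeff q j
  coeff-⊕ []      q       j       = refl
  coeff-⊕ (a ∷ p) []      zero    = sym (ℕP.+-identityʳ a)
  coeff-⊕ (a ∷ p) []      (suc j) = sym (ℕP.+-identityʳ _)
  coeff-⊕ (a ∷ p) (b ∷ q) zero    = refl
  coeff-⊕ (a ∷ p) (b ∷ q) (suc j) = coeff-⊕ p q j

  coeffs-⊕ : ∀ p q → coeffs (p ⊕ q) ≈ coeffs p ⊞ coeffs q
  coeffs-⊕ p q j = trans (cong +_ (coeff-⊕ p q j)) (ℤP.pos-+ (coeff p j) (coeff q j))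

  coeff-scale : ∀ a p j → coeff (scale a p) j ≡ a ℕ.* coeff p j
  coeff-scale a []      j       = sym (ℕP.*-zeroʳ a)
  coeff-scale a (b ∷ p) zero    = refl
  coeff-scale a (b ∷ p) (suc j) = coeff-scale a p j

  coeffs-⊗ : ∀ p q → coeffs (p ⊗ q) ≈ coeffs p ⊠ coeffs q
  coeffs-⊗ []      q j       = sym (⊠-zeroˡ (coeffs q) j)
  coeffs-⊗ (a ∷ p) q zero    = begin
    + coeff (scale a q ⊕ (0 ∷ p ⊗ q)) 0      ≡⟨ cong +_ (coeff-⊕ (scale a q) (0 ∷ p ⊗ q) 0) ⟩
    + (coeff (scale a q) 0 ℕ.+ 0)            ≡⟨ cong +_ (trans (ℕP.+-identityʳ _) (coeff-scale a q 0)) ⟩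
    + (a ℕ.* coeff q 0)                      ≡⟨ ℤP.pos-* a (coeff q 0) ⟩
    + a * coeffs q 0                         ∎
    where open ≡-Reasoning
  coeffs-⊗ (a ∷ p) q (suc j) = begin
    + coeff (scale a q ⊕ (0 ∷ p ⊗ q)) (suc j)
      ≡⟨ cong +_ (coeff-⊕ (scale a q) (0 ∷ p ⊗ q) (suc j)) ⟩
    + (coeff (scale a q) (suc j) ℕ.+ coeff (p ⊗ q) j)
      ≡⟨ ℤP.pos-+ _ (coeff (p ⊗ q) j) ⟩
    + coeff (scale a q) (suc j) + coeffs (p ⊗ q) j
      ≡⟨ cong₂ _+_ (trans (cong +_ (coeff-scale a q (suc j))) (ℤP.pos-* a _)) (coeffs-⊗ p q j) ⟩
    + a * coeffs q (suc j) + (coeffs p ⊠ coeffs q) j ∎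
    where open ≡-Reasoning

  coeffs-shift-zero : ∀ a p → coeffs (shift (a ∷ p)) 0 ≡ + a + coeffs (shift p) 0
  coeffs-shift-zero a p = trans (coeffs-⊕ (a ∷ []) ((1 ∷ 1 ∷ []) ⊗ shift p) 0)
    (cong (λ z → + a + z) (trans (coeffs-⊗ (1 ∷ 1 ∷ []) (shift p) 0) (ℤP.*-identityˡ _)))

  coeffs-shift-suc : ∀ a p j →
    coeffs (shift (a ∷ p)) (suc j) ≡ coeffs (shift p) (suc j) + coeffs (shift p) j
  coeffs-shift-suc a p j = begin
    coeffs (shift (a ∷ p)) (suc j)
      ≡⟨ coeffs-⊕ (a ∷ []) ((1 ∷ 1 ∷ []) ⊗ shift p) (suc j) ⟩
    0ℤ + coeffs ((1 ∷ 1 ∷ []) ⊗ shift p) (suc j)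
      ≡⟨ ℤP.+-identityˡ _ ⟩
    coeffs ((1 ∷ 1 ∷ []) ⊗ shift p) (suc j)
      ≡⟨ coeffs-⊗ (1 ∷ 1 ∷ []) (shift p) (suc j) ⟩
    1ℤ * coeffs (shift p) (suc j) + (coeffs (1 ∷ []) ⊠ coeffs (shift p)) j
      ≡⟨ cong₂ _+_ (ℤP.*-identityˡ (coeffs (shift p) (suc j)))
                   (trans (⊠-cong one ≈-refl j) (⊠-identityˡ (coeffs (shift p)) j)) ⟩
    coeffs (shift p) (suc j) + coeffs (shift p) j ∎
    where
    open ≡-Reasoning
    one : coeffs (1 ∷ []) ≈ cst 1ℤ
    one zero    = refl
    one (suc _) = refl

  shift-vanishes : ∀ p d → VanishesFrom (coeffs p) d → VanishesFrom (coeffs (shift p)) d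
  shift-vanishes []      d V j       _     = refl
  shift-vanishes (a ∷ p) d V zero    d≤0   =
    trans (coeffs-shift-zero a p) (cong₂ _+_ (V 0 d≤0) (IH 0 (ℕP.pred-mono-≤ d≤0)))
    where IH = shift-vanishes p (ℕ.pred d) (tail-vanishes d V)
  shift-vanishes (a ∷ p) d V (suc j) d≤1+j =
    trans (coeffs-shift-suc a p j) (cong₂ _+_ (IH (suc j) (ℕP.m≤n⇒m≤1+n pd≤j)) (IH j pd≤j))
    where
    IH   = shift-vanishes p (ℕ.pred d) (tail-vanishes d V)
    pd≤j = ℕP.pred-mono-≤ d≤1+j

  shift-top : ∀ p d → DegreeAtMost (coeffs p) d → coeffs (shift p) d ≡ coeffs p d
  shift-top []      d       D = refl
  shift-top (a ∷ p) zero    D = begin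
    coeffs (shift (a ∷ p)) 0    ≡⟨ coeffs-shift-zero a p ⟩
    + a + coeffs (shift p) 0    ≡⟨ cong (λ z → + a + z) (shift-vanishes p 0 (tail-vanishes 1 D) 0 z≤n) ⟩
    + a + 0ℤ                    ≡⟨ ℤP.+-identityʳ (+ a) ⟩
    + a                         ∎
    where open ≡-Reasoning
  shift-top (a ∷ p) (suc e) D = begin
    coeffs (shift (a ∷ p)) (suc e)             ≡⟨ coeffs-shift-suc a p e ⟩
    coeffs (shift p) (suc e) + coeffs (shift p) e
      ≡⟨ cong₂ _+_ (shift-vanishes p (suc e) Dp (suc e) ℕP.≤-refl) (shift-top p e Dp) ⟩
    0ℤ + coeffs p e                            ≡⟨ ℤP.+-identityˡ _ ⟩
    coeffs p e                                 ∎
    where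
    open ≡-Reasoning
    Dp = tail-vanishes (suc (suc e)) D

  shift-second : ∀ p d → DegreeAtMost (coeffs p) (suc d) →
    coeffs (shift p) d ≡ coeffs p d + + suc d * coeffs p (suc d)
  shift-second []      d       D = sym (trans (ℤP.+-identityˡ _) (ℤP.*-zeroʳ (+ suc d)))
  shift-second (a ∷ p) zero    D = begin
    coeffs (shift (a ∷ p)) 0        ≡⟨ coeffs-shift-zero a p ⟩
    + a + coeffs (shift p) 0        ≡⟨ cong (λ z → + a + z) (shift-top p 0 (tail-vanishes 2 D)) ⟩
    + a + coeffs p 0                ≡⟨ cong (λ z → + a + z) (ℤP.*-identityˡ (coeffs p 0)) ⟨
    + a + + 1 * coeffs p 0          ∎
    where open ≡-Reasoning
  shift-second (a ∷ p) (suc e) D = begin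
    coeffs (shift (a ∷ p)) (suc e)                       ≡⟨ coeffs-shift-suc a p e ⟩
    coeffs (shift p) (suc e) + coeffs (shift p) e
      ≡⟨ cong₂ _+_ (shift-top p (suc e) Dp) (shift-second p e Dp) ⟩
    coeffs p (suc e) + (coeffs p e + + suc e * coeffs p (suc e))
      ≡⟨ collect (coeffs p (suc e)) (coeffs p e) (+ suc e) ⟩
    coeffs p e + + suc (suc e) * coeffs p (suc e)        ∎
    where
    open ≡-Reasoning
    Dp = tail-vanishes (suc (suc (suc e))) D
    collect : ∀ x w m → x + (w + m * x) ≡ w + (+ 1 + m) * x
    collect = solve-∀

module Recurrence where
  open import Data.Nat as ℕ using (ℕ; zero; suc; _∸_; _≤_; _<_; s≤s; ⌈_/2⌉)
  open import Data.Nat.Induction using (<-rec)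
  import Data.Nat.Properties as ℕP
  open import Data.Integer using (_+_; 0ℤ)
  open import Data.List using ([]; _∷_; map; foldr; applyUpTo; _++_; length)
  open import Data.List.Properties using (length-++)
  open import Data.Sum using (inj₁; inj₂)
  open import Relation.Binary.PropositionalEquality
  open import Function using (_∘_; id)
  open import Defs
  open PowerSeries
  open FiniteSums
  open Degrees
  open PolyCoefficients
  open IndexArithmetic using (⌈/2⌉-subadditive)

  length-table : ∀ n → length (table n) ≡ suc n
  length-table zero          = refl
  length-table (suc zero)    = refl
  length-table (suc (suc n)) = trans (length-++ (table (suc n)))
    (trans (cong (ℕ._+ 1) (length-table (suc n))) (cong suc (ℕP.+-comm (suc n) 1)))

  nth-snoc : ∀ t x k → k < length t → nth (t ++ x ∷ []) k ≡ nth t k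
  nth-snoc (p ∷ t) x zero    _         = refl
  nth-snoc (p ∷ t) x (suc k) (s≤s k<l) = nth-snoc t x k k<l

  nth-last : ∀ t x → nth (t ++ x ∷ []) (length t) ≡ x
  nth-last []      x = refl
  nth-last (p ∷ t) x = nth-last t x

  table-extends : ∀ n k → k ≤ n → nth (table (suc n)) k ≡ nth (table n) k
  table-extends zero    zero _   = refl
  table-extends (suc n) k    k≤n =
    nth-snoc (table (suc n)) _ k (subst (k <_) (sym (length-table (suc n))) (s≤s k≤n))

  nth-table : ∀ n k → k ≤ n → nth (table n) k ≡ PT k
  nth-table zero    zero _   = refl
  nth-table (suc n) k    k≤n with ℕP.m≤n⇒m<n∨m≡n k≤n
  ... | inj₂ refl        = refl
  ... | inj₁ (s≤s k≤n′) = trans (table-extends n k k≤n′) (nth-table n k k≤n′)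

  PT-step : ∀ n → PT (suc (suc n)) ≡ shift (PT (suc n)) ⊕ conv (table (suc n)) (suc n)
  PT-step n = trans (cong (nth (table (suc n) ++ _ ∷ [])) (sym (length-table (suc n))))
                    (nth-last (table (suc n)) _)

  coeffs-Σ : ∀ (F : ℕ → Poly) g m j →
    coeffs (foldr _⊕_ [] (map F (map suc (applyUpTo g m)))) j ≡ Σ< m (λ i → coeffs (F (suc (g i))) j)
  coeffs-Σ F g zero    j = refl
  coeffs-Σ F g (suc m) j = trans (coeffs-⊕ (F (suc (g 0))) _ j)
    (cong (λ w → coeffs (F (suc (g 0))) j + w) (coeffs-Σ F (g ∘ suc) m j))

  P : ℕ → Series
  P k = coeffs (PT k)

  P-step : ∀ n j →
    P (suc (suc n)) j ≡ coeffs (shift (PT (suc n))) j + Σ< n (λ i → (P (suc i) ⊠ P (n ∸ i)) j)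
  P-step n j = begin
    P (suc (suc n)) j
      ≡⟨ cong (λ p → coeffs p j) (PT-step n) ⟩
    coeffs (shift (PT (suc n)) ⊕ conv t (suc n)) j
      ≡⟨ coeffs-⊕ (shift (PT (suc n))) _ j ⟩
    coeffs (shift (PT (suc n))) j + coeffs (conv t (suc n)) j
      ≡⟨ cong (λ w → coeffs (shift (PT (suc n))) j + w) (trans (coeffs-Σ term id n j) (Σ<-cong n summand)) ⟩
    coeffs (shift (PT (suc n))) j + Σ< n (λ i → (P (suc i) ⊠ P (n ∸ i)) j) ∎
    where
    open ≡-Reasoning
    t = table (suc n)
    term : ℕ → Poly
    term k = nth t k ⊗ nth t (suc n ∸ k)
    summand : ∀ i → i < n → coeffs (term (suc i)) j ≡ (P (suc i) ⊠ P (n ∸ i)) j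
    summand i i<n = trans
      (cong (λ p → coeffs p j) (cong₂ _⊗_ (nth-table (suc n) (suc i) (s≤s (ℕP.<⇒≤ i<n)))
                                          (nth-table (suc n) (n ∸ i) (ℕP.≤-trans (ℕP.m∸n≤m n i) (ℕP.n≤1+n n)))))
      (coeffs-⊗ (PT (suc i)) (PT (n ∸ i)) j)

  P-degree : ∀ k → DegreeAtMost (P k) ⌈ k /2⌉
  P-degree = <-rec (λ k → DegreeAtMost (P k) ⌈ k /2⌉) bound
    where
    bound : ∀ k → (∀ {i} → i < k → DegreeAtMost (P i) ⌈ i /2⌉) → DegreeAtMost (P k) ⌈ k /2⌉
    bound zero          IH j _  = refl
    bound (suc zero)    IH (suc zero) (s≤s ())
    bound (suc zero)    IH (suc (suc j)) _ = refl
    bound (suc (suc n)) IH j lt = trans (P-step n j) (cong₂ _+_ shifted products)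
      where
      shifted : coeffs (shift (PT (suc n))) j ≡ 0ℤ
      shifted = shift-vanishes (PT (suc n)) _ (IH (ℕP.n<1+n (suc n))) j
                  (ℕP.≤-<-trans (ℕP.⌈n/2⌉-mono (ℕP.n≤1+n (suc n))) lt)
      products : Σ< n (λ i → (P (suc i) ⊠ P (n ∸ i)) j) ≡ 0ℤ
      products = Σ<-zero n term-vanishes
        where
        degrees : ∀ i → i < n → ⌈ suc i /2⌉ ℕ.+ ⌈ n ∸ i /2⌉ < j
        degrees i i<n = ℕP.≤-<-trans (ℕP.≤-trans (⌈/2⌉-subadditive (suc i) (n ∸ i))
          (ℕP.≤-reflexive (cong (λ v → ⌈ suc (suc v) /2⌉) (ℕP.m+[n∸m]≡n (ℕP.<⇒≤ i<n))))) lt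
        term-vanishes : ∀ i → i < n → (P (suc i) ⊠ P (n ∸ i)) j ≡ 0ℤ
        term-vanishes i i<n = ⊠-degree ⌈ suc i /2⌉ ⌈ n ∸ i /2⌉
          (IH (s≤s (s≤s (ℕP.<⇒≤ i<n)))) (IH (s≤s (ℕP.≤-trans (ℕP.m∸n≤m n i) (ℕP.n≤1+n n)))) j (degrees i i<n)

module CoefficientSeries where
  open import Data.Nat as ℕ using (ℕ; zero; suc; _∸_; _<_; s≤s)
  import Data.Nat.Properties as ℕP
  open import Data.Integer using (ℤ; +_; _+_; _*_; 0ℤ)
  import Data.Integer.Properties as ℤP
  open import Data.Integer.Tactic.RingSolver using (solve-∀)
  open import Relation.Binary.PropositionalEquality
  open import Defs
  open PowerSeries
  open SeriesCalculus
  open FiniteSums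
  open Degrees
  open PolyCoefficients
  open Recurrence
  open IndexArithmetic

  Even Odd : ℕ → Series
  Even m = P (2 ℕ.* m)
  Odd  m = P (suc (2 ℕ.* m))

  Even-degree : ∀ m → DegreeAtMost (Even m) m
  Even-degree m = subst (DegreeAtMost (Even m)) (⌈double/2⌉ m) (P-degree (2 ℕ.* m))

  Odd-degree : ∀ m → DegreeAtMost (Odd m) (suc m)
  Odd-degree m = subst (DegreeAtMost (Odd m)) (⌈odd/2⌉ m) (P-degree (suc (2 ℕ.* m)))

  Even-step : ∀ q j → Even (suc q) j ≡ coeffs (shift (PT (suc (2 ℕ.* q)))) j
    + (Σ< q (λ a → (Odd a ⊠ Even (q ∸ a)) j) + Σ< q (λ a → (Even (suc a) ⊠ Odd (q ∸ suc a)) j))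
  Even-step q j = begin
    Even (suc q) j                                               ≡⟨ cong (λ v → P v j) (two-suc q) ⟩
    P (suc (suc (2 ℕ.* q))) j                                    ≡⟨ P-step (2 ℕ.* q) j ⟩
    coeffs (shift (PT (suc (2 ℕ.* q)))) j + Σ< (2 ℕ.* q) h
      ≡⟨ cong (λ w → coeffs (shift (PT (suc (2 ℕ.* q)))) j + w)
              (trans (Σ<-even-odd q h) (cong₂ _+_ (Σ<-cong q even) (Σ<-cong q odd))) ⟩
    coeffs (shift (PT (suc (2 ℕ.* q)))) j
      + (Σ< q (λ a → (Odd a ⊠ Even (q ∸ a)) j) + Σ< q (λ a → (Even (suc a) ⊠ Odd (q ∸ suc a)) j)) ∎
    where
    open ≡-Reasoning
    h : ℕ → ℤ
    h i = (P (suc i) ⊠ P (2 ℕ.* q ∸ i)) j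
    even : ∀ a → a < q → h (2 ℕ.* a) ≡ (Odd a ⊠ Even (q ∸ a)) j
    even a _ = cong (λ v → (Odd a ⊠ P v) j) (double-∸ q a)
    odd : ∀ a → a < q → h (suc (2 ℕ.* a)) ≡ (Even (suc a) ⊠ Odd (q ∸ suc a)) j
    odd a a<q = cong₂ (λ u v → (P u ⊠ P v) j) (sym (two-suc a)) (double-∸-odd q a a<q)

  Odd-step : ∀ p j → Odd (suc p) j ≡ coeffs (shift (PT (suc (suc (2 ℕ.* p))))) j
    + (Σ< (suc p) (λ a → (Odd a ⊠ Odd (p ∸ a)) j) + Σ< p (λ a → (Even (suc a) ⊠ Even (p ∸ a)) j))
  Odd-step p j = begin
    Odd (suc p) j                                                ≡⟨ cong (λ v → P (suc v) j) (two-suc p) ⟩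
    P (suc (suc (suc (2 ℕ.* p)))) j                              ≡⟨ P-step (suc (2 ℕ.* p)) j ⟩
    coeffs (shift (PT (suc (suc (2 ℕ.* p))))) j + Σ< (suc (2 ℕ.* p)) h
      ≡⟨ cong (λ w → coeffs (shift (PT (suc (suc (2 ℕ.* p))))) j + w)
              (trans (Σ<-even-odd′ p h) (cong₂ _+_ (Σ<-cong (suc p) even) (Σ<-cong p odd))) ⟩
    coeffs (shift (PT (suc (suc (2 ℕ.* p))))) j
      + (Σ< (suc p) (λ a → (Odd a ⊠ Odd (p ∸ a)) j) + Σ< p (λ a → (Even (suc a) ⊠ Even (p ∸ a)) j)) ∎
    where
    open ≡-Reasoning
    h : ℕ → ℤ
    h i = (P (suc i) ⊠ P (suc (2 ℕ.* p) ∸ i)) j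
    even : ∀ a → a < suc p → h (2 ℕ.* a) ≡ (Odd a ⊠ Odd (p ∸ a)) j
    even a (s≤s a≤p) = cong (λ v → (Odd a ⊠ P v) j) (odd-∸-double p a a≤p)
    odd : ∀ a → a < p → h (suc (2 ℕ.* a)) ≡ (Even (suc a) ⊠ Even (p ∸ a)) j
    odd a _ = cong₂ (λ u v → (P u ⊠ P v) j) (sym (two-suc a)) (double-∸ p a)

  Even-suc-degree : ∀ p → DegreeAtMost (P (suc (suc (2 ℕ.* p)))) (suc p)
  Even-suc-degree p = subst (λ v → DegreeAtMost (P v) (suc p)) (two-suc p) (Even-degree (suc p))

  A B C T : Series
  A zero    = 0ℤ
  A (suc q) = Odd q (suc q)
  B zero    = 0ℤ
  B (suc q) = Odd q q
  C q       = Even q q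
  T q       = + τ q

  ⊠-doubled : ∀ f g n → (cst (+ 2) ⊠ (f ⊠ g)) n ≡ (f ⊠ g) n + (g ⊠ f) n
  ⊠-doubled f g n =
    trans (cst-⊠ (+ 2) (f ⊠ g) n) (trans (double ((f ⊠ g) n)) (cong (λ w → (f ⊠ g) n + w) (⊠-comm f g n)))
    where
    double : ∀ x → + 2 * x ≡ x + x
    double = solve-∀

  C-equation : C ≈ A ⊞ cst (+ 2) ⊠ (A ⊠ C)
  C-equation zero    = refl
  C-equation (suc q) = begin
    Even (suc q) (suc q)
      ≡⟨ Even-step q (suc q) ⟩
    coeffs (shift (PT (suc (2 ℕ.* q)))) (suc q)
      + (Σ< q (λ a → (Odd a ⊠ Even (q ∸ a)) (suc q)) + Σ< q (λ a → (Even (suc a) ⊠ Odd (q ∸ suc a)) (suc q)))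
      ≡⟨ cong₂ _+_ (shift-top (PT (suc (2 ℕ.* q))) (suc q) (Odd-degree q))
                   (cong₂ _+_ (trans (Σ<-cong q even) (sym (⊠-as-inner-Σ A C q refl refl)))
                              (trans (Σ<-cong q odd)  (sym (⊠-as-inner-Σ C A q refl refl)))) ⟩
    A (suc q) + ((A ⊠ C) (suc q) + (C ⊠ A) (suc q))
      ≡⟨ cong (λ w → A (suc q) + w) (sym (⊠-doubled A C (suc q))) ⟩
    A (suc q) + (cst (+ 2) ⊠ (A ⊠ C)) (suc q) ∎
    where
    open ≡-Reasoning
    even : ∀ a → a < q → (Odd a ⊠ Even (q ∸ a)) (suc q) ≡ A (suc a) * C (q ∸ a)
    even a a<q = ⊠-top (suc a) (q ∸ a) (Odd-degree a) (Even-degree (q ∸ a)) (cong suc (ℕP.m+[n∸m]≡n (ℕP.<⇒≤ a<q)))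
    odd : ∀ a → a < q → (Even (suc a) ⊠ Odd (q ∸ suc a)) (suc q) ≡ C (suc a) * A (q ∸ a)
    odd a a<q = trans
      (⊠-top (suc a) (suc (q ∸ suc a)) (Even-degree (suc a)) (Odd-degree (q ∸ suc a))
             (cong suc (trans (ℕP.+-suc a (q ∸ suc a)) (ℕP.m+[n∸m]≡n a<q))))
      (cong (λ v → C (suc a) * A v) (sym (suc-∸ a<q)))

  -- A = y + A²: the top coefficients of the odd members are Catalan numbers.
  A-equation : A ≈ y ⊞ A ⊠ A
  A-equation zero          = refl
  A-equation (suc zero)    = refl
  A-equation (suc (suc p)) = begin
    Odd (suc p) (suc (suc p))
      ≡⟨ Odd-step p (suc (suc p)) ⟩
    coeffs (shift (PT (suc (suc (2 ℕ.* p))))) (suc (suc p))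
      + (Σ< (suc p) (λ a → (Odd a ⊠ Odd (p ∸ a)) (suc (suc p)))
         + Σ< p (λ a → (Even (suc a) ⊠ Even (p ∸ a)) (suc (suc p))))
      ≡⟨ cong₂ _+_ (shift-vanishes (PT (suc (suc (2 ℕ.* p)))) _ (Even-suc-degree p) (suc (suc p)) ℕP.≤-refl)
                   (cong₂ _+_ (trans (Σ<-cong (suc p) even) (sym (⊠-as-inner-Σ A A (suc p) refl refl)))
                              (Σ<-zero p odd)) ⟩
    0ℤ + ((A ⊠ A) (suc (suc p)) + 0ℤ)
      ≡⟨ cong (λ w → 0ℤ + w) (ℤP.+-identityʳ ((A ⊠ A) (suc (suc p)))) ⟩
    y (suc (suc p)) + (A ⊠ A) (suc (suc p)) ∎
    where
    open ≡-Reasoning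
    even : ∀ a → a < suc p → (Odd a ⊠ Odd (p ∸ a)) (suc (suc p)) ≡ A (suc a) * A (suc p ∸ a)
    even a (s≤s a≤p) = trans
      (⊠-top (suc a) (suc (p ∸ a)) (Odd-degree a) (Odd-degree (p ∸ a))
             (cong suc (trans (ℕP.+-suc a (p ∸ a)) (cong suc (ℕP.m+[n∸m]≡n a≤p)))))
      (cong (λ v → A (suc a) * A v) (sym (suc-∸ a≤p)))
    odd : ∀ a → a < p → (Even (suc a) ⊠ Even (p ∸ a)) (suc (suc p)) ≡ 0ℤ
    odd a a<p = ⊠-degree (suc a) (p ∸ a) (Even-degree (suc a)) (Even-degree (p ∸ a)) (suc (suc p))
      (s≤s (s≤s (ℕP.≤-reflexive (ℕP.m+[n∸m]≡n (ℕP.<⇒≤ a<p)))))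

  B-equation : B ≈ y ⊠ C ⊞ cst (+ 2) ⊠ (A ⊠ B) ⊞ y ⊠ (C ⊠ C)
  B-equation zero          = refl
  B-equation (suc zero)    = refl
  B-equation (suc (suc p)) = begin
    Odd (suc p) (suc p)
      ≡⟨ Odd-step p (suc p) ⟩
    coeffs (shift (PT (suc (suc (2 ℕ.* p))))) (suc p)
      + (Σ< (suc p) (λ a → (Odd a ⊠ Odd (p ∸ a)) (suc p)) + Σ< p (λ a → (Even (suc a) ⊠ Even (p ∸ a)) (suc p)))
      ≡⟨ cong₂ _+_ (trans (shift-top (PT (suc (suc (2 ℕ.* p)))) (suc p) (Even-suc-degree p))
                          (cong (λ v → P v (suc p)) (sym (two-suc p))))
                   (cong₂ _+_ (trans (Σ<-cong (suc p) even) (Σ<-+ (suc p) AB BA)) (Σ<-cong p odd)) ⟩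
    C (suc p) + ((Σ< (suc p) AB + Σ< (suc p) BA) + Σ< p (λ a → C (suc a) * C (p ∸ a)))
      ≡⟨ cong (λ w → C (suc p) + w)
              (cong₂ _+_ (cong₂ _+_ (sym (⊠-as-inner-Σ A B (suc p) refl refl)) (sym (⊠-as-inner-Σ B A (suc p) refl refl)))
                         (sym (⊠-as-inner-Σ C C p refl refl))) ⟩
    C (suc p) + (((A ⊠ B) (suc (suc p)) + (B ⊠ A) (suc (suc p))) + (C ⊠ C) (suc p))
      ≡⟨ regroup (C (suc p)) ((A ⊠ B) (suc (suc p))) ((B ⊠ A) (suc (suc p))) ((C ⊠ C) (suc p)) ⟩
    C (suc p) + ((A ⊠ B) (suc (suc p)) + (B ⊠ A) (suc (suc p))) + (C ⊠ C) (suc p)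
      ≡⟨ cong₂ _+_ (cong₂ _+_ (sym (y-⊠ C (suc p))) (sym (⊠-doubled A B (suc (suc p)))))
                   (sym (y-⊠ (C ⊠ C) (suc p))) ⟩
    (y ⊠ C ⊞ cst (+ 2) ⊠ (A ⊠ B) ⊞ y ⊠ (C ⊠ C)) (suc (suc p)) ∎
    where
    open ≡-Reasoning
    regroup : ∀ a b c d → a + ((b + c) + d) ≡ a + (b + c) + d
    regroup = solve-∀
    AB BA : ℕ → ℤ
    AB a = A (suc a) * B (suc p ∸ a)
    BA a = B (suc a) * A (suc p ∸ a)
    even : ∀ a → a < suc p → (Odd a ⊠ Odd (p ∸ a)) (suc p) ≡ AB a + BA a
    even a (s≤s a≤p) = trans
      (⊠-second a (p ∸ a) (Odd-degree a) (Odd-degree (p ∸ a)) (cong suc (ℕP.m+[n∸m]≡n a≤p)))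
      (cong (λ v → A (suc a) * B v + B (suc a) * A v) (sym (suc-∸ a≤p)))
    odd : ∀ a → a < p → (Even (suc a) ⊠ Even (p ∸ a)) (suc p) ≡ C (suc a) * C (p ∸ a)
    odd a a<p = ⊠-top (suc a) (p ∸ a) (Even-degree (suc a)) (Even-degree (p ∸ a)) (cong suc (ℕP.m+[n∸m]≡n (ℕP.<⇒≤ a<p)))

  -- T = θA + B + 2AT + 2BC: the second coefficient of the even members;
  -- the term θA comes from the Taylor shift.
  T-equation : T ≈ θ A ⊞ B ⊞ cst (+ 2) ⊠ (A ⊠ T) ⊞ cst (+ 2) ⊠ (B ⊠ C)
  T-equation zero    = refl
  T-equation (suc q) = begin
    Even (suc q) q
      ≡⟨ Even-step q q ⟩
    coeffs (shift (PT (suc (2 ℕ.* q)))) q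
      + (Σ< q (λ a → (Odd a ⊠ Even (q ∸ a)) q) + Σ< q (λ a → (Even (suc a) ⊠ Odd (q ∸ suc a)) q))
      ≡⟨ cong₂ _+_ (shift-second (PT (suc (2 ℕ.* q))) q (Odd-degree q))
                   (cong₂ _+_ (trans (Σ<-cong q even) (Σ<-+ q AT BC)) (trans (Σ<-cong q odd) (Σ<-+ q CB TA))) ⟩
    (B (suc q) + θ A (suc q)) + ((Σ< q AT + Σ< q BC) + (Σ< q CB + Σ< q TA))
      ≡⟨ cong (λ w → (B (suc q) + θ A (suc q)) + w)
           (cong₂ _+_ (cong₂ _+_ (sym (⊠-as-inner-Σ A T q refl refl)) (sym (⊠-as-inner-Σ B C q refl refl)))
                      (cong₂ _+_ (sym (⊠-as-inner-Σ C B q refl refl)) (sym (⊠-as-inner-Σ T A q refl refl)))) ⟩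
    (B (suc q) + θ A (suc q)) + (((A ⊠ T) (suc q) + (B ⊠ C) (suc q)) + ((C ⊠ B) (suc q) + (T ⊠ A) (suc q)))
      ≡⟨ regroup (B (suc q)) (θ A (suc q)) ((A ⊠ T) (suc q)) ((B ⊠ C) (suc q)) ((C ⊠ B) (suc q)) ((T ⊠ A) (suc q)) ⟩
    θ A (suc q) + B (suc q) + ((A ⊠ T) (suc q) + (T ⊠ A) (suc q)) + ((B ⊠ C) (suc q) + (C ⊠ B) (suc q))
      ≡⟨ cong₂ (λ u v → θ A (suc q) + B (suc q) + u + v) (sym (⊠-doubled A T (suc q))) (sym (⊠-doubled B C (suc q))) ⟩
    (θ A ⊞ B ⊞ cst (+ 2) ⊠ (A ⊠ T) ⊞ cst (+ 2) ⊠ (B ⊠ C)) (suc q) ∎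
    where
    open ≡-Reasoning
    regroup : ∀ b x at bc cb ta → (b + x) + ((at + bc) + (cb + ta)) ≡ x + b + (at + ta) + (bc + cb)
    regroup = solve-∀
    AT BC CB TA : ℕ → ℤ
    AT a = A (suc a) * T (q ∸ a)
    BC a = B (suc a) * C (q ∸ a)
    CB a = C (suc a) * B (q ∸ a)
    TA a = T (suc a) * A (q ∸ a)
    even : ∀ a → a < q → (Odd a ⊠ Even (q ∸ a)) q ≡ AT a + BC a
    even a a<q = trans
      (⊠-second a (q ∸ suc a) (Odd-degree a) (subst (DegreeAtMost (Even (q ∸ a))) (suc-∸ a<q) (Even-degree (q ∸ a)))
                (ℕP.m+[n∸m]≡n a<q))
      (cong₂ (λ u v → A (suc a) * Even (q ∸ a) u + B (suc a) * Even (q ∸ a) v)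
             (cong ℕ.pred (sym (suc-∸ a<q))) (sym (suc-∸ a<q)))
    odd : ∀ a → a < q → (Even (suc a) ⊠ Odd (q ∸ suc a)) q ≡ CB a + TA a
    odd a a<q = trans
      (⊠-second a (q ∸ suc a) (Even-degree (suc a)) (Odd-degree (q ∸ suc a)) (ℕP.m+[n∸m]≡n a<q))
      (cong (λ v → C (suc a) * B v + T (suc a) * A v) (sym (suc-∸ a<q)))

-- The series D = Σ C(2n,n) yⁿ = (1−4y)^{−1/2}, its fifth power, and E = y/(1−4y),
-- handled through the differential equation (1 − 4y)·θF = a·y·F.
module CentralSeries where
  open import Data.Nat as ℕ using (zero; suc)
  open import Data.Integer using (ℤ; +_; _+_; _*_; -_; 0ℤ; 1ℤ)
  import Data.Integer.Properties as ℤP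
  open import Data.Integer.Tactic.RingSolver using (solve-∀)
  open import Relation.Binary.PropositionalEquality
  open PowerSeries
  open SeriesSolver
  open SeriesCalculus
  open CentralBinomial

  Δ : Series
  Δ = cst (+ 1) ⊞ cst (- (+ 4)) ⊠ y

  :Δ : ∀ {n} → Polynomial n → Polynomial n
  :Δ Y = con (+ 1) :+ con (- (+ 4)) :* Y

  Δ-⊠ : ∀ G → Δ ⊠ G ≈ G ⊞ cst (- (+ 4)) ⊠ (y ⊠ G)
  Δ-⊠ G = solve 2 (λ g Y → :Δ Y :* g := g :+ con (- (+ 4)) :* (Y :* g)) (λ _ → refl) G y

  Δ-⊠-zero : ∀ G → (Δ ⊠ G) 0 ≡ G 0
  Δ-⊠-zero G = trans (Δ-⊠ G 0) (trans (cong (λ z → G 0 + z) (cst-⊠ (- (+ 4)) (y ⊠ G) 0)) (ℤP.+-identityʳ (G 0)))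

  Δ-⊠-suc : ∀ G n → (Δ ⊠ G) (suc n) ≡ G (suc n) + - (+ 4) * G n
  Δ-⊠-suc G n = trans (Δ-⊠ G (suc n))
    (cong (λ z → G (suc n) + z) (trans (cst-⊠ (- (+ 4)) (y ⊠ G) (suc n)) (cong (- (+ 4) *_) (y-⊠ G n))))

  y-⊠-scaled : ∀ c G n → (cst c ⊠ (y ⊠ G)) (suc n) ≡ c * G n
  y-⊠-scaled c G n = trans (cst-⊠ c (y ⊠ G) (suc n)) (cong (c *_) (y-⊠ G n))

  -- The differential equation (1 − 4y)·θF = a·y·F, satisfied by (1 − 4y)^{−a/4}.
  SolvesODE : ℤ → Series → Set
  SolvesODE a F = Δ ⊠ θ F ≈ cst a ⊠ (y ⊠ F)

  -- Exponents add: by the Leibniz rule, products of solutions are solutions.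
  ODE-⊠ : ∀ {a b F G} → SolvesODE a F → SolvesODE b G → SolvesODE (a + b) (F ⊠ G)
  ODE-⊠ {a} {b} {F} {G} eF eG = ≈-trans
    (by-certificate
      (solve 8 (λ f g f′ g′ ca cb U Y →
          :Δ Y :* U := (ca :+ cb) :* (Y :* (f :* g))
            :+ (:Δ Y :* (U :- (f′ :* g :+ f :* g′))
                :+ g :* (:Δ Y :* f′ :- ca :* (Y :* f))
                :+ f :* (:Δ Y :* g′ :- cb :* (Y :* g))))
        (λ _ → refl) F G (θ F) (θ G) (cst a) (cst b) (θ (F ⊠ G)) y)
      (times-relation (θ-⊠ F G) Δ ⊞𝟘 times-relation eF G ⊞𝟘 times-relation eG F))
    (⊠-cong (≈-sym (cst-⊞ a b)) ≈-refl)

  ODE-^ : ∀ {a F} k → SolvesODE a F → SolvesODE (+ k * a) (F ^ k)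
  ODE-^ {a} {F} zero    eF n = begin
    (Δ ⊠ θ (cst 1ℤ)) n                ≡⟨ ⊠-cong ≈-refl (θ-cst 1ℤ) n ⟩
    (Δ ⊠ 𝟘) n                         ≡⟨ ⊠-zeroʳ Δ n ⟩
    0ℤ                                ≡⟨ ℤP.*-zeroˡ ((y ⊠ cst 1ℤ) n) ⟨
    0ℤ * (y ⊠ cst 1ℤ) n               ≡⟨ cst-⊠ 0ℤ (y ⊠ cst 1ℤ) n ⟨
    (cst (+ 0 * a) ⊠ (y ⊠ cst 1ℤ)) n  ∎
    where open ≡-Reasoning
  ODE-^ {a} {F} (suc k) eF = ≈-trans (ODE-⊠ eF (ODE-^ k eF))
    (⊠-cong (λ n → cong (λ c → cst c n) (sym (expand (+ k) a))) ≈-refl)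
    where
    expand : ∀ m a → (+ 1 + m) * a ≡ a + m * a
    expand = solve-∀

  D : Series
  D n = + central n

  D-ODE : SolvesODE (+ 2) D
  D-ODE zero    = trans (Δ-⊠-zero (θ D)) (sym (ℤP.*-zeroʳ (+ 2)))
  D-ODE (suc n) = begin
    (Δ ⊠ θ D) (suc n)                                   ≡⟨ Δ-⊠-suc (θ D) n ⟩
    + suc n * + central (suc n) + - (+ 4) * (+ n * D n)
      ≡⟨ cong (λ z → z + - (+ 4) * (+ n * D n)) shifted-central ⟩
    + 2 * (+ 1 + + 2 * + n) * D n + - (+ 4) * (+ n * D n) ≡⟨ collect (+ n) (D n) ⟩
    + 2 * D n                                           ≡⟨ y-⊠-scaled (+ 2) D n ⟨
    (cst (+ 2) ⊠ (y ⊠ D)) (suc n)                       ∎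
    where
    open ≡-Reasoning
    shifted-central : + suc n * + central (suc n) ≡ + 2 * (+ 1 + + 2 * + n) * D n
    shifted-central = trans (sym (ℤP.pos-* (suc n) (central (suc n)))) (trans (cong +_ (central-step n))
             (trans (ℤP.pos-* (2 ℕ.* suc (2 ℕ.* n)) (central n))
                    (cong (_* D n) (trans (ℤP.pos-* 2 (suc (2 ℕ.* n))) (cong (λ z → + 2 * (+ 1 + z)) (ℤP.pos-* 2 n))))))
    collect : ∀ m d → + 2 * (+ 1 + + 2 * m) * d + - (+ 4) * (m * d) ≡ + 2 * d
    collect = solve-∀

  ODE-recurrence : ∀ {a F} → SolvesODE a F → ∀ n → + suc n * F (suc n) ≡ (a + + 4 * + n) * F n
  ODE-recurrence {a} {F} eF n = begin
    + suc n * F (suc n)                                          ≡⟨ split (+ suc n * F (suc n)) (+ n * F n) ⟩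
    (+ suc n * F (suc n) + - (+ 4) * (+ n * F n)) + + 4 * (+ n * F n)
      ≡⟨ cong (λ z → z + + 4 * (+ n * F n)) (trans (sym (Δ-⊠-suc (θ F) n)) (trans (eF (suc n)) (y-⊠-scaled a F n))) ⟩
    a * F n + + 4 * (+ n * F n)                                  ≡⟨ collect a (F n) (+ n) ⟩
    (a + + 4 * + n) * F n                                        ∎
    where
    open ≡-Reasoning
    split : ∀ u v → u ≡ (u + - (+ 4) * v) + + 4 * v
    split = solve-∀
    collect : ∀ a f m → a * f + + 4 * (m * f) ≡ (a + + 4 * m) * f
    collect = solve-∀

  -- 3·[yⁿ] D⁵ = C(2n,n)(2n+1)(2n+3): both sides satisfy the recurrence of
  -- exponent 10 and agree at n = 0.
  D⁵-coefficient : ∀ n → + 3 * (D ^ 5) n ≡ + closedForm n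
  D⁵-coefficient zero    = refl
  D⁵-coefficient (suc n) = ℤP.*-cancelˡ-≡ (+ suc n) _ _ (begin
    + suc n * (+ 3 * (D ^ 5) (suc n))          ≡⟨ swap (+ suc n) (+ 3) ((D ^ 5) (suc n)) ⟩
    + 3 * (+ suc n * (D ^ 5) (suc n))          ≡⟨ cong (+ 3 *_) (ODE-recurrence (ODE-^ 5 D-ODE) n) ⟩
    + 3 * ((+ 10 + + 4 * + n) * (D ^ 5) n)     ≡⟨ swap (+ 3) (+ 10 + + 4 * + n) ((D ^ 5) n) ⟩
    (+ 10 + + 4 * + n) * (+ 3 * (D ^ 5) n)     ≡⟨ cong ((+ 10 + + 4 * + n) *_) (D⁵-coefficient n) ⟩
    (+ 10 + + 4 * + n) * + closedForm n
      ≡⟨ cong (_* + closedForm n) (cong (λ z → + 10 + z) (sym (ℤP.pos-* 4 n))) ⟩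
    + (10 ℕ.+ 4 ℕ.* n) * + closedForm n        ≡⟨ ℤP.pos-* (10 ℕ.+ 4 ℕ.* n) (closedForm n) ⟨
    + ((10 ℕ.+ 4 ℕ.* n) ℕ.* closedForm n)      ≡⟨ cong +_ (closedForm-recurrence n) ⟨
    + (suc n ℕ.* closedForm (suc n))           ≡⟨ ℤP.pos-* (suc n) (closedForm (suc n)) ⟩
    + suc n * + closedForm (suc n)             ∎)
    where
    open ≡-Reasoning
    swap : ∀ a b c → a * (b * c) ≡ b * (a * c)
    swap = solve-∀

  -- E = y/(1 − 4y) = Σ_{n≥1} 4ⁿ⁻¹ yⁿ.
  E : Series
  E zero    = 0ℤ
  E (suc n) = + (4 ℕ.^ n)

  Δ⊠E≈y : Δ ⊠ E ≈ y
  Δ⊠E≈y zero          = Δ-⊠-zero E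
  Δ⊠E≈y (suc zero)    = Δ-⊠-suc E 0
  Δ⊠E≈y (suc (suc n)) = trans (Δ-⊠-suc E (suc n))
    (trans (cong (λ z → z + - (+ 4) * + (4 ℕ.^ n)) (ℤP.pos-* 4 (4 ℕ.^ n))) (cancel (+ (4 ℕ.^ n))))
    where
    cancel : ∀ a → + 4 * a + - (+ 4) * a ≡ 0ℤ
    cancel = solve-∀

module Elimination where
  open import Data.Nat as ℕ using (zero; suc)
  open import Data.Integer using (+_; _+_; _*_; -_; 0ℤ; 1ℤ)
  import Data.Integer.Properties as ℤP
  open import Relation.Binary.PropositionalEquality
  open PowerSeries
  open SeriesSolver
  open SeriesCalculus
  open CentralSeries

  module Solution (A B C T : Series) (A₀≡0 : A 0 ≡ 0ℤ)
    (A-eq : A ≈ y ⊞ A ⊠ A)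
    (C-eq : C ≈ A ⊞ cst (+ 2) ⊠ (A ⊠ C))
    (B-eq : B ≈ y ⊠ C ⊞ cst (+ 2) ⊠ (A ⊠ B) ⊞ y ⊠ (C ⊠ C))
    (T-eq : T ≈ θ A ⊞ B ⊞ cst (+ 2) ⊠ (A ⊠ T) ⊞ cst (+ 2) ⊠ (B ⊠ C)) where

    σ : Series
    σ = cst (+ 1) ⊞ cst (- (+ 2)) ⊠ A

    -- Solver syntax for σ, and for the difference of the two sides of 2Cσ = 1 − σ
    -- (which occurs as a factor in the certificates below).
    :σ : ∀ {n} → Polynomial n → Polynomial n
    :σ a = con (+ 1) :+ con (- (+ 2)) :* a

    :C-relation : ∀ {n} → Polynomial n → Polynomial n → Polynomial n
    :C-relation s c = con (+ 2) :* (c :* s) :- (con (+ 1) :- s)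

    σ₀≡1 : σ 0 ≡ 1ℤ
    σ₀≡1 = cong (λ z → + 1 + - (+ 2) * z) A₀≡0

    σ²≈Δ : σ ⊠ σ ≈ Δ
    σ²≈Δ = by-certificate
      (solve 2 (λ a Y → :σ a :* :σ a := :Δ Y :+ con (- (+ 4)) :* (a :- (Y :+ a :* a))) (λ _ → refl) A y)
      (times-relation A-eq (cst (- (+ 4))))

    θσ : θ σ ≈ cst (- (+ 2)) ⊠ θ A
    θσ = ≈-trans (θ-⊞ _ _) λ n →
      trans (cong₂ _+_ (θ-cst (+ 1) n) (θ-scale (- (+ 2)) A n)) (ℤP.+-identityˡ _)

    θΔ : θ Δ ≈ cst (- (+ 4)) ⊠ y
    θΔ = ≈-trans (θ-⊞ _ _) λ n →
      trans (cong₂ _+_ (θ-cst (+ 1) n) (trans (θ-scale (- (+ 4)) y n) (⊠-cong ≈-refl θ-y n))) (ℤP.+-identityˡ _)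

    -- Differentiating σ² = Δ: σ·θA = y.
    σθA≈y : σ ⊠ θ A ≈ y
    σθA≈y = cst-cancel (- (+ 4)) (σ ⊠ θ A) y (≈-trans
      (by-certificate
        (solve 3 (λ s s′ x → con (- (+ 4)) :* (s :* x)
                   := s′ :* s :+ s :* s′ :+ (con (- (+ 2)) :* s) :* (s′ :- con (- (+ 2)) :* x))
          (λ _ → refl) σ (θ σ) (θ A))
        (times-relation θσ (cst (- (+ 2)) ⊠ σ)))
      (≈-trans (≈-sym (θ-⊠ σ σ)) (≈-trans (θ-cong σ²≈Δ) θΔ)))

    σθσ≈-2y : σ ⊠ θ σ ≈ cst (- (+ 2)) ⊠ y
    σθσ≈-2y = by-certificate
      (solve 4 (λ s s′ x Y → s :* s′ := con (- (+ 2)) :* Y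
                   :+ (s :* (s′ :- con (- (+ 2)) :* x) :+ con (- (+ 2)) :* (s :* x :- Y)))
        (λ _ → refl) σ (θ σ) (θ A) y)
      (times-relation θσ σ ⊞𝟘 times-relation σθA≈y (cst (- (+ 2))))

    2Cσ≈1-σ : cst (+ 2) ⊠ (C ⊠ σ) ≈ cst (+ 1) ⊞ ⊟ σ
    2Cσ≈1-σ = by-certificate
      (solve 2 (λ a c → con (+ 2) :* (c :* :σ a)
                   := (con (+ 1) :- :σ a) :+ con (+ 2) :* (c :- (a :+ con (+ 2) :* (a :* c))))
        (λ _ → refl) A C)
      (times-relation C-eq (cst (+ 2)))

    Bσ≈yC+yC² : B ⊠ σ ≈ y ⊠ C ⊞ y ⊠ (C ⊠ C)
    Bσ≈yC+yC² = by-certificate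
      (solve 4 (λ a b c Y → b :* :σ a
                   := Y :* c :+ Y :* (c :* c) :+ con (+ 1) :* (b :- (Y :* c :+ con (+ 2) :* (a :* b) :+ Y :* (c :* c))))
        (λ _ → refl) A B C y)
      (times-relation B-eq (cst (+ 1)))

    -- Eliminating C: Bσ³ = y².
    Bσ³≈y² : B ⊠ σ ^ 3 ≈ y ⊠ y
    Bσ³≈y² = cst-cancel (+ 4) (B ⊠ σ ^ 3) (y ⊠ y) (by-certificate
      (solve 4 (λ s b c Y → con (+ 4) :* (b :* s :^ 3) := con (+ 4) :* (Y :* Y)
                   :+ ((con (+ 4) :* (s :* s)) :* (b :* s :- (Y :* c :+ Y :* (c :* c)))
                       :+ (:- Y) :* (s :* s :- :Δ Y)
                       :+ (Y :* (con (+ 2) :+ :C-relation s c)) :* :C-relation s c))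
        (λ _ → refl) σ B C y)
      (times-relation Bσ≈yC+yC² (cst (+ 4) ⊠ (σ ⊠ σ)) ⊞𝟘 times-relation σ²≈Δ (⊟ y)
         ⊞𝟘 times-relation 2Cσ≈1-σ (y ⊠ (cst (+ 2) ⊞ (cst (+ 2) ⊠ (C ⊠ σ) ⊞ ⊟ (cst (+ 1) ⊞ ⊟ σ))))))

    -- Eliminating B and C: Tσ⁵ = yσ³ + y².
    Tσ⁵≈yσ³+y² : T ⊠ σ ^ 5 ≈ y ⊠ σ ^ 3 ⊞ y ⊠ y
    Tσ⁵≈yσ³+y² = by-certificate
      (solve 6 (λ a b c t x Y → t :* :σ a :^ 5 := Y :* :σ a :^ 3 :+ Y :* Y
          :+ (:σ a :^ 3 :* (:σ a :* x :- Y)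
              :+ :σ a :* (b :* :σ a :^ 3 :- Y :* Y)
              :+ (con (+ 1) :- :σ a :+ :C-relation (:σ a) c) :* (b :* :σ a :^ 3 :- Y :* Y)
              :+ (Y :* Y) :* :C-relation (:σ a) c
              :+ :σ a :^ 4 :* (t :- (x :+ b :+ con (+ 2) :* (a :* t) :+ con (+ 2) :* (b :* c)))))
        (λ _ → refl) A B C T (θ A) y)
      (times-relation σθA≈y (σ ^ 3) ⊞𝟘 times-relation Bσ³≈y² σ
        ⊞𝟘 times-relation Bσ³≈y² (cst (+ 1) ⊞ ⊟ σ ⊞ (cst (+ 2) ⊠ (C ⊠ σ) ⊞ ⊟ (cst (+ 1) ⊞ ⊟ σ)))
        ⊞𝟘 times-relation 2Cσ≈1-σ (y ⊠ y) ⊞𝟘 times-relation T-eq (σ ^ 4))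

    -- D is the inverse of σ: both (1 − 4y)^{∓1/2}.  θ(Dσ) vanishes because
    -- (1 − 4y)·σ·θ(Dσ) is a combination of the known relations.
    Dσ≈1 : D ⊠ σ ≈ cst 1ℤ
    Dσ≈1 zero    = cong (+ 1 *_) σ₀≡1
    Dσ≈1 (suc n) = θ-kernel (unit-cancel (Δ ⊠ σ) (θ (D ⊠ σ)) (cong (+ 1 *_) σ₀≡1) Δσθ[Dσ]≈0) n
      where
      Δσθ[Dσ]≈0 : (Δ ⊠ σ) ⊠ θ (D ⊠ σ) ≈ 𝟘
      Δσθ[Dσ]≈0 = ≈-trans
        (by-certificate
          (solve 6 (λ s s′ d d′ u Y → (:Δ Y :* s) :* u := con 0ℤ
              :+ ((:Δ Y :* s) :* (u :- (d′ :* s :+ d :* s′))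
                  :+ (con (+ 2) :* (Y :* d)) :* (s :* s :- :Δ Y)
                  :+ (s :* s) :* (:Δ Y :* d′ :- con (+ 2) :* (Y :* d))
                  :+ (d :* :Δ Y) :* (s :* s′ :- con (- (+ 2)) :* Y)))
            (λ _ → refl) σ (θ σ) D (θ D) (θ (D ⊠ σ)) y)
          (times-relation (θ-⊠ D σ) (Δ ⊠ σ) ⊞𝟘 times-relation σ²≈Δ (cst (+ 2) ⊠ (y ⊠ D))
            ⊞𝟘 times-relation D-ODE (σ ⊠ σ) ⊞𝟘 times-relation σθσ≈-2y (D ⊠ Δ)))
        cst-zero

    D⁵σ⁵≈1 : D ^ 5 ⊠ σ ^ 5 ≈ cst 1ℤ
    D⁵σ⁵≈1 = by-certificate
      (solve 2 (λ d s → d :^ 5 :* s :^ 5 := con (+ 1)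
          :+ ((d :* s) :^ 4 :+ (d :* s) :^ 3 :+ (d :* s) :^ 2 :+ d :* s :+ con (+ 1)) :* (d :* s :- con (+ 1)))
        (λ _ → refl) D σ)
      (times-relation Dσ≈1 _)

    Eσ⁵≈yσ³ : E ⊠ σ ^ 5 ≈ y ⊠ σ ^ 3
    Eσ⁵≈yσ³ = by-certificate
      (solve 3 (λ e s Y → e :* s :^ 5 := Y :* s :^ 3 :+ (s :^ 3 :* (:Δ Y :* e :- Y) :+ (e :* s :^ 3) :* (s :* s :- :Δ Y)))
        (λ _ → refl) E σ y)
      (times-relation Δ⊠E≈y (σ ^ 3) ⊞𝟘 times-relation σ²≈Δ (E ⊠ σ ^ 3))

    -- Dividing Tσ⁵ = yσ³ + y² by σ⁵.
    T≈E+y²D⁵ : T ≈ E ⊞ y ⊠ (y ⊠ D ^ 5)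
    T≈E+y²D⁵ = difference-zero (unit-cancel (σ ^ 5) _ (^-unit {σ} σ₀≡1 5) σ⁵[T−R]≈0)
      where
      σ⁵[T−R]≈0 : σ ^ 5 ⊠ (T ⊞ ⊟ (E ⊞ y ⊠ (y ⊠ D ^ 5))) ≈ 𝟘
      σ⁵[T−R]≈0 = ≈-trans
        (by-certificate
          (solve 5 (λ t e d s Y → s :^ 5 :* (t :- (e :+ Y :* (Y :* d))) := con 0ℤ
              :+ (con (+ 1) :* (t :* s :^ 5 :- (Y :* s :^ 3 :+ Y :* Y))
                  :+ con (- (+ 1)) :* (e :* s :^ 5 :- Y :* s :^ 3)
                  :+ (:- (Y :* Y)) :* (d :* s :^ 5 :- con (+ 1))))
            (λ _ → refl) T E (D ^ 5) σ y)
          (times-relation Tσ⁵≈yσ³+y² (cst (+ 1)) ⊞𝟘 times-relation Eσ⁵≈yσ³ (cst (- (+ 1)))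
            ⊞𝟘 times-relation D⁵σ⁵≈1 (⊟ (y ⊠ y))))
        cst-zero

    T-coefficient : ∀ j → T (suc (suc (suc j))) ≡ + (4 ℕ.^ suc (suc j)) + (D ^ 5) (suc j)
    T-coefficient j = trans (T≈E+y²D⁵ (suc (suc (suc j))))
      (cong (λ z → + (4 ℕ.^ suc (suc j)) + z) (trans (y-⊠ (y ⊠ D ^ 5) (suc (suc j))) (y-⊠ (D ^ 5) (suc j))))
open import Defs
open import Data.Nat using (ℕ; _+_; _*_; _∸_; _^_; _≤_)
open import Data.Nat.Combinatorics using (_C_)
open import Data.Product using (_×_)
open import Relation.Binary.PropositionalEquality using (_≡_)

open import Data.Nat using (suc; s≤s; z≤n)
open import Data.Product using (_,_)
open import Relation.Binary.PropositionalEquality using (refl; sym; trans; cong; cong₂; module ≡-Reasoning)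
import Data.Nat.Properties as ℕP
import Data.Integer as ℤ
import Data.Integer.Properties as ℤP
open import Data.Nat.Tactic.RingSolver using (solve-∀)
open CentralBinomial using (central; closedForm; closedForm-step)
open CentralSeries using (D; D⁵-coefficient)
open CoefficientSeries using (A-equation; B-equation; C-equation; T-equation)
open Elimination.Solution CoefficientSeries.A CoefficientSeries.B CoefficientSeries.C CoefficientSeries.T
  refl A-equation C-equation B-equation T-equation using (T-coefficient)

τ-formula : ∀ j → 3 * τ (3 + j) ≡ 3 * 4 ^ (2 + j) + closedForm (suc j)
τ-formula j = ℤP.+-injective (begin
  ℤ.+ (3 * τ (3 + j))                                   ≡⟨ ℤP.pos-* 3 (τ (3 + j)) ⟩
  ℤ.+ 3 ℤ.* CoefficientSeries.T (3 + j)                 ≡⟨ cong (ℤ.+ 3 ℤ.*_) (T-coefficient j) ⟩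
  ℤ.+ 3 ℤ.* (ℤ.+ (4 ^ (2 + j)) ℤ.+ (D PowerSeries.^ 5) (suc j))
    ≡⟨ ℤP.*-distribˡ-+ (ℤ.+ 3) (ℤ.+ (4 ^ (2 + j))) ((D PowerSeries.^ 5) (suc j)) ⟩
  ℤ.+ 3 ℤ.* ℤ.+ (4 ^ (2 + j)) ℤ.+ ℤ.+ 3 ℤ.* (D PowerSeries.^ 5) (suc j)
    ≡⟨ cong₂ ℤ._+_ (sym (ℤP.pos-* 3 (4 ^ (2 + j)))) (D⁵-coefficient (suc j)) ⟩
  ℤ.+ (3 * 4 ^ (2 + j)) ℤ.+ ℤ.+ closedForm (suc j)     ≡⟨ ℤP.pos-+ (3 * 4 ^ (2 + j)) (closedForm (suc j)) ⟨
  ℤ.+ (3 * 4 ^ (2 + j) + closedForm (suc j))            ∎)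
  where open ≡-Reasoning

odd-factors : ∀ j → 2 * (2 * (3 + j) ∸ 5) * (2 * (3 + j) ∸ 3) * (2 * (3 + j) ∸ 1)
                  ≡ 2 * (1 + 2 * j) * (3 + 2 * j) * (5 + 2 * j)
odd-factors j = cong₂ _*_ (cong₂ _*_ (cong (2 *_) (minus 5 (ℕP.m≤m+n 5 1))) (minus 3 (ℕP.m≤m+n 3 3)))
                          (minus 1 (ℕP.m≤m+n 1 5))
  where
  expand : ∀ j → 2 * (3 + j) ≡ 6 + 2 * j
  expand = solve-∀
  minus : ∀ c → c ≤ 6 → 2 * (3 + j) ∸ c ≡ (6 ∸ c) + 2 * j
  minus c c≤6 = trans (cong (_∸ c) (expand j)) (ℕP.+-∸-comm (2 * j) c≤6)

-- τ_2 and τ_4 are computed directly; for q ≥ 3 the identity is τ-formula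
-- multiplied by q − 2, using (j+1)·h(j+1) = 2(2j+1)(2j+3)(2j+5)·C(2j,j).
mainTheorem5 : τ 1 ≡ 1 × τ 2 ≡ 5 ×
    ((q : ℕ) → 3 ≤ q →
    3 * (q ∸ 2) * τ q
    ≡ 3 * (q ∸ 2) * 4 ^ (q ∸ 1)
    + 2 * (2 * q ∸ 5) * (2 * q ∸ 3) * (2 * q ∸ 1) * ((2 * (q ∸ 3)) C (q ∸ 3)))
mainTheorem5 = refl , refl , large
  where
  open ≡-Reasoning
  reorder : ∀ j t → 3 * suc j * t ≡ suc j * (3 * t)
  reorder = solve-∀
  large : (q : ℕ) → 3 ≤ q →
    3 * (q ∸ 2) * τ q
    ≡ 3 * (q ∸ 2) * 4 ^ (q ∸ 1)
    + 2 * (2 * q ∸ 5) * (2 * q ∸ 3) * (2 * q ∸ 1) * ((2 * (q ∸ 3)) C (q ∸ 3))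
  large (suc (suc (suc j))) (s≤s (s≤s (s≤s z≤n))) = begin
    3 * suc j * τ (3 + j)                                  ≡⟨ reorder j (τ (3 + j)) ⟩
    suc j * (3 * τ (3 + j))                                ≡⟨ cong (suc j *_) (τ-formula j) ⟩
    suc j * (3 * 4 ^ (2 + j) + closedForm (suc j))
      ≡⟨ ℕP.*-distribˡ-+ (suc j) (3 * 4 ^ (2 + j)) (closedForm (suc j)) ⟩
    suc j * (3 * 4 ^ (2 + j)) + suc j * closedForm (suc j)
      ≡⟨ cong₂ _+_ (sym (reorder j (4 ^ (2 + j)))) (closedForm-step j) ⟩
    3 * suc j * 4 ^ (2 + j) + 2 * (1 + 2 * j) * (3 + 2 * j) * (5 + 2 * j) * central j
      ≡⟨ cong (λ f → 3 * suc j * 4 ^ (2 + j) + f * central j) (odd-factors j) ⟨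
    3 * suc j * 4 ^ (2 + j) + 2 * (2 * (3 + j) ∸ 5) * (2 * (3 + j) ∸ 3) * (2 * (3 + j) ∸ 1) * central j ∎
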